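{- For all integers $0\le k\le n$, \[ [2]_q^{\,k}\,[k]_{q^2}!\;S_B[n,k]\;=\;\sum_{\ell=0}^{k} q^{k(k-2\ell)}\,B_{n,\ell}(q)\,{n-\ell \brack k-\ell}_{q^2}. \]
   Context: For $k\ge1$, $[k]_q=1+q+\dots+q^{k-1}$, $[0]_q=0$, $[n]_q!=[1]_q[2]_q\cdots[n]_q$, and ${n\brack k}_q=\frac{[n]_q!}{[k]_q![n-k]_q!}$ for $0\le k\le n$; $[k]_{q^2}!$ and ${n\brack k}_{q^2}$ denote these with $q$ replaced by $q^2$. The type B $q$-Stirling numbers of the second kind $S_B[n,k]$ are defined by $S_B[0,k]=\delta_{0k}$ and $S_B[n,k]=S_B[n-1,k-1]+[2k+1]_q\,S_B[n-1,k]$ for $n\ge1$. Let $\mathcal{B}_n$ be the group of signed permutations of $[n]=\{1,\dots,n\}$, i.e. bijections $\pi$ of $\{\pm1,\dots,\pm n\}$ with $\pi(-i)=-\pi(i)$, written $\pi=\pi_1\cdots\pi_n$ with $\pi_i=\pi(i)$, and set $\pi_0=0$; integers are compared in the usual order $-n<\dots<-1<0<1<\dots<n$. The type B descent set is $\mathrm{Des}_B(\pi)=\{i\in\{0,1,\dots,n-1\}:\pi_i>\pi_{i+1}\}$, $\mathrm{des}_B(\pi)=|\mathrm{Des}_B(\pi)|$, $\mathrm{neg}(\pi)=|\{i\in[n]:\pi_i<0\}|$, and the flag-major index is $\mathrm{fmaj}(\pi)=\sum_{i\in\mathrm{Des}_B(\pi)}2i+\mathrm{neg}(\pi)$. Define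 $B_{n,k}(q)=\sum_{\pi\in\mathcal{B}_n,\ \mathrm{des}_B(\pi)=k}q^{\mathrm{fmaj}(\pi)}$. -}

module Defs where

open import Data.Nat as ℕ using (ℕ; zero; suc; _∸_; _≡ᵇ_)
open import Data.Integer as ℤ using (ℤ; +_; -[1+_]; ∣_∣)
open import Data.Bool using (Bool; true; false; if_then_else_; _∧_; not)
open import Data.List using (List; []; _∷_; map; concatMap; filterᵇ; foldr; upTo; length)
open import Relation.Nullary.Decidable using (does)
open import Algebra.Bundles using (CommutativeRing)
open import Level using (Level)

-- a signed permutation of [n] is represented by its window π₁ ⋯ πₙ (a list of integers)

alphabet : ℕ → List ℤ
alphabet n = concatMap (λ i → (+ suc i) ∷ -[1+ i ] ∷ []) (upTo n)

words : ℕ → ℕ → List (List ℤ)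
words n zero = [] ∷ []
words n (suc m) = concatMap (λ a → map (a ∷_) (words n m)) (alphabet n)

elemᵇ : ℕ → List ℕ → Bool
elemᵇ x [] = false
elemᵇ x (y ∷ ys) = if x ≡ᵇ y then true else elemᵇ x ys

distinctᵇ : List ℕ → Bool
distinctᵇ [] = true
distinctᵇ (x ∷ xs) = not (elemᵇ x xs) ∧ distinctᵇ xs

-- a word of length n over {±1,…,±n} is (the window of) a signed permutation
-- iff the absolute values |π₁|,…,|πₙ| are pairwise distinct
isSignedPermᵇ : List ℤ → Bool
isSignedPermᵇ w = distinctᵇ (map ∣_∣ w)

signedPerms : ℕ → List (List ℤ)
signedPerms n = filterᵇ isSignedPermᵇ (words n n)

_>ᵇ_ : ℤ → ℤ → Bool
a >ᵇ b = does (b ℤ.<? a)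

-- descents of the word π₀ π₁ ⋯ πₙ with π₀ = 0:
-- desPos i (x ∷ y ∷ rest) lists the positions j ≥ i (position of x being i) with x > y
desPos : ℕ → List ℤ → List ℕ
desPos i [] = []
desPos i (x ∷ []) = []
desPos i (x ∷ y ∷ rest) =
  if x >ᵇ y then i ∷ desPos (suc i) (y ∷ rest) else desPos (suc i) (y ∷ rest)

DesB : List ℤ → List ℕ
DesB π = desPos 0 (+ 0 ∷ π)

desB : List ℤ → ℕ
desB π = length (DesB π)

isNegᵇ : ℤ → Bool
isNegᵇ (+ _) = false
isNegᵇ -[1+ _ ] = true

neg : List ℤ → ℕ
neg π = length (filterᵇ isNegᵇ π)

sumℕ : List ℕ → ℕ
sumℕ = foldr ℕ._+_ 0

fmaj : List ℤ → ℕ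
fmaj π = sumℕ (map (λ i → 2 ℕ.* i) (DesB π)) ℕ.+ neg π

-- q-analogues, evaluated in a commutative ring R at an invertible element q
-- (an identity of Laurent polynomials in ℤ[q,q⁻¹] is the same as its validity
--  in every commutative ring at every unit q)

module QAnalogues {c ℓ : Level} (R : CommutativeRing c ℓ) (q q⁻¹ : CommutativeRing.Carrier R) where
  open CommutativeRing R hiding (zero)

  infixr 8 _^_
  _^_ : Carrier → ℕ → Carrier
  x ^ zero = 1#
  x ^ suc m = x * (x ^ m)

  qᶻ : ℤ → Carrier
  qᶻ (+ m) = q ^ m
  qᶻ -[1+ m ] = q⁻¹ ^ suc m

  sumR : List Carrier → Carrier
  sumR = foldr _+_ 0#

  qint : Carrier → ℕ → Carrier
  qint x m = sumR (map (x ^_) (upTo m))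

  qfact : Carrier → ℕ → Carrier
  qfact x zero = 1#
  qfact x (suc m) = qfact x m * qint x (suc m)

  -- Gaussian binomial [m choose j]_x, via the q-Pascal rule
  -- [m+1 choose j+1] = [m choose j] + x^{j+1} [m choose j+1]
  -- (this is the polynomial [m]!/([j]![m-j]!) for j ≤ m, and 0 for j > m)
  qbinom : Carrier → ℕ → ℕ → Carrier
  qbinom x m zero = 1#
  qbinom x zero (suc j) = 0#
  qbinom x (suc m) (suc j) = qbinom x m j + (x ^ suc j) * qbinom x m (suc j)

  SB : ℕ → ℕ → Carrier
  SB zero zero = 1#
  SB zero (suc k) = 0#
  SB (suc n) zero = qint q 1 * SB n zero
  SB (suc n) (suc k) = SB n k + qint q (2 ℕ.* suc k ℕ.+ 1) * SB n (suc k)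

  Bnk : ℕ → ℕ → Carrier
  Bnk n k = sumR (map (λ π → q ^ fmaj π) (filterᵇ (λ π → desB π ≡ᵇ k) (signedPerms n)))

module Submission where

-- Both sides satisfy X(n+1, k) = [2k]_q X(n, k-1) + [2k+1]_q X(n, k) with the same initial
-- values. For the left-hand side this is the recurrence defining S_B. For the right-hand side it
-- follows from a recurrence for B_{n,k}: every signed permutation of [n+1] arises exactly once by
-- inserting ±(n+1) into one of the n+1 gaps after π₀ = 0 of a signed permutation π of [n], and if
-- des_B π = d these 2n+2 insertions have flag-major indices fmaj π + t with d descents (0 ≤ t ≤ 2d)
-- and fmaj π + 2d + 1 + t with d+1 descents (0 ≤ t ≤ 2(n-d)). Hence
--   B_{n+1,k} = [2k+1]_q B_{n,k} + q^{2k-1} [2n-2k+3]_q B_{n,k-1},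
-- and substituting this into the right-hand side, the recurrence reduces, term by term, to the
-- q-Pascal rule and the absorption identity [j+1] [m, j+1] = [m-j] [m, j] for Gaussian binomials
-- in base q².

open import Defs
open import Level using (Level)
open import Data.Nat using (ℕ; _≤_; _∸_)
open import Data.Integer using (+_)
open import Data.List using (map; upTo)
open import Algebra.Bundles using (CommutativeRing)
import Data.Integer as ℤ
import Data.Nat as ℕ
import Relation.Binary.PropositionalEquality as ≡

module Insertion where

  open import Data.Nat using (ℕ; zero; suc; _+_; _*_; _≤_; s≤s)
  open import Data.Nat.Properties using (+-suc; +-identityʳ)
  open import Data.Nat.Tactic.RingSolver using (solve-∀)
  open import Data.Integer using (ℤ; -[1+_]; ∣_∣)
  open import Data.Integer.Properties using (<-asym)
  open import Data.Bool using (true; false; if_then_else_)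
  open import Data.List using (List; []; _∷_; map; length; _++_)
  open import Data.List.Properties using (map-++; map-∘; map-cong; ++-assoc)
  open import Data.List.Relation.Unary.All using (All; []; _∷_)
  open import Data.List.Relation.Binary.Permutation.Propositional using (_↭_; prep; swap; refl; module PermutationReasoning)
  open import Data.List.Relation.Binary.Permutation.Propositional.Properties using (map⁺; shifts)
  open import Data.Product using (_×_; _,_)
  open import Relation.Nullary.Decidable using (dec-true; dec-false)
  open import Relation.Binary.PropositionalEquality

  -- (des, fmaj)-type statistics of a word whose first letter sits at position i
  desFrom : ℕ → List ℤ → ℕ
  desFrom i w = length (desPos i w)

  majFrom : ℕ → List ℤ → ℕ
  majFrom i w = sumℕ (map (λ j → 2 * j) (desPos i w))

  stat : ℕ → List ℤ → ℕ × ℕ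
  stat i w = desFrom i w , majFrom i w + neg w

  ascents : List ℤ → ℕ
  ascents [] = 0
  ascents (x ∷ []) = 0
  ascents (x ∷ y ∷ w) = if x >ᵇ y then ascents (y ∷ w) else suc (ascents (y ∷ w))

  negBit : ℤ → ℕ
  negBit (ℤ.+ _) = 0
  negBit -[1+ _ ] = 1

  neg-∷ : ∀ x w → neg (x ∷ w) ≡ negBit x + neg w
  neg-∷ (ℤ.+ _) w = refl
  neg-∷ -[1+ _ ] w = refl

  desFrom-offset : ∀ i j w → desFrom i w ≡ desFrom j w
  desFrom-offset i j [] = refl
  desFrom-offset i j (x ∷ []) = refl
  desFrom-offset i j (x ∷ y ∷ w) = step (x >ᵇ y) (desFrom-offset (suc i) (suc j) (y ∷ w))
    where
      step : ∀ b {r r′ : List ℕ} → length r ≡ length r′ →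
             length (if b then i ∷ r else r) ≡ length (if b then j ∷ r′ else r′)
      step true = cong suc
      step false e = e

  majFrom-suc : ∀ i w → majFrom (suc i) w ≡ majFrom i w + 2 * desFrom i w
  majFrom-suc i [] = refl
  majFrom-suc i (x ∷ []) = refl
  majFrom-suc i (x ∷ y ∷ w) = step (x >ᵇ y) (majFrom-suc (suc i) (y ∷ w))
    where
      Σ2 : List ℕ → ℕ
      Σ2 r = sumℕ (map (λ j → 2 * j) r)
      arith : ∀ i m d → 2 * suc i + (m + 2 * d) ≡ 2 * i + m + 2 * suc d
      arith = solve-∀
      step : ∀ b {r r′ : List ℕ} → Σ2 r′ ≡ Σ2 r + 2 * length r →
             Σ2 (if b then suc i ∷ r′ else r′) ≡ Σ2 (if b then i ∷ r else r) + 2 * length (if b then i ∷ r else r)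
      step true {r} e = trans (cong (λ m → 2 * suc i + m) e) (arith i (Σ2 r) (length r))
      step false e = e

  shiftStat : ℕ → ℕ → ℕ × ℕ → ℕ × ℕ
  shiftStat δ c (d , W) = δ + d , c + W

  stat-descent : ∀ i x y w → x >ᵇ y ≡ true →
    stat i (x ∷ y ∷ w) ≡ shiftStat 1 (2 * i + negBit x) (stat (suc i) (y ∷ w))
  stat-descent i x y w x>y rewrite x>y | neg-∷ x (y ∷ w) =
    cong (suc (desFrom (suc i) (y ∷ w)) ,_) (arith (2 * i) (majFrom (suc i) (y ∷ w)) (negBit x) (neg (y ∷ w)))
    where
      arith : ∀ a m b n → a + m + (b + n) ≡ a + b + (m + n)
      arith = solve-∀

  stat-ascent : ∀ i x y w → x >ᵇ y ≡ false →
    stat i (x ∷ y ∷ w) ≡ shiftStat 0 (negBit x) (stat (suc i) (y ∷ w))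
  stat-ascent i x y w x≯y rewrite x≯y | neg-∷ x (y ∷ w) =
    cong (desFrom (suc i) (y ∷ w) ,_) (arith (majFrom (suc i) (y ∷ w)) (negBit x) (neg (y ∷ w)))
    where
      arith : ∀ m b n → m + (b + n) ≡ b + (m + n)
      arith = solve-∀

  stat-suc : ∀ i w → stat (suc i) w ≡ shiftStat 0 (2 * desFrom i w) (stat i w)
  stat-suc i w = cong₂ _,_ (desFrom-offset (suc i) i w)
    (trans (cong (_+ neg w) (majFrom-suc i w)) (arith (majFrom i w) (desFrom i w) (neg w)))
    where
      arith : ∀ m d n → m + 2 * d + n ≡ 2 * d + (m + n)
      arith = solve-∀

  desFrom+ascents : ∀ i x w → desFrom i (x ∷ w) + ascents (x ∷ w) ≡ length w
  desFrom+ascents i x [] = refl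
  desFrom+ascents i x (y ∷ w) = step (x >ᵇ y) (desFrom+ascents (suc i) y w)
    where
      step : ∀ b {r : List ℕ} {a} → length r + a ≡ length w →
             length (if b then i ∷ r else r) + (if b then a else suc a) ≡ suc (length w)
      step true e = cong suc e
      step false {r} {a} e = trans (+-suc (length r) a) (cong suc e)

  Small : ℕ → ℤ → Set
  Small n x = ∣ x ∣ ≤ n

  top bottom : ℕ → ℤ
  top n = ℤ.+ suc n
  bottom n = -[1+ n ]

  module _ {n : ℕ} where

    private
      <top : ∀ x → Small n x → x ℤ.< top n
      <top (ℤ.+ _) x≤n = ℤ.+<+ (s≤s x≤n)
      <top -[1+ _ ] _ = ℤ.-<+

      bottom< : ∀ x → Small n x → bottom n ℤ.< x
      bottom< (ℤ.+ _) _ = ℤ.-<+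
      bottom< -[1+ _ ] x≤n = ℤ.-<- x≤n

    top>ᵇ : ∀ x → Small n x → top n >ᵇ x ≡ true
    top>ᵇ x x≤n = dec-true (x ℤ.<? top n) (<top x x≤n)

    >ᵇtop : ∀ x → Small n x → x >ᵇ top n ≡ false
    >ᵇtop x x≤n = dec-false (top n ℤ.<? x) (<-asym (<top x x≤n))

    bottom>ᵇ : ∀ x → Small n x → bottom n >ᵇ x ≡ false
    bottom>ᵇ x x≤n = dec-false (x ℤ.<? bottom n) (<-asym (bottom< x x≤n))

    >ᵇbottom : ∀ x → Small n x → x >ᵇ bottom n ≡ true
    >ᵇbottom x x≤n = dec-true (bottom n ℤ.<? x) (bottom< x x≤n)

  -- insertion of ±(n+1) at every position except the first, whose letter plays the role of π₀ = 0
  insert± : ℕ → List ℤ → List (List ℤ)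
  insert± n [] = (bottom n ∷ []) ∷ (top n ∷ []) ∷ []
  insert± n (x ∷ w) = (bottom n ∷ x ∷ w) ∷ (top n ∷ x ∷ w) ∷ map (x ∷_) (insert± n w)

  range : ℕ → ℕ → List ℕ
  range w zero = []
  range w (suc m) = w ∷ range (suc w) m

  block : ℕ → ℕ → ℕ → List (ℕ × ℕ)
  block d w m = map (d ,_) (range w m)

  map-shiftStat-block : ∀ δ c d w m → map (shiftStat δ c) (block d w m) ≡ block (δ + d) (c + w) m
  map-shiftStat-block δ c d w zero = refl
  map-shiftStat-block δ c d w (suc m) = cong (_ ∷_)
    (trans (map-shiftStat-block δ c d (suc w) m) (cong (λ v → block (δ + d) v m) (+-suc c w)))

  block-++ : ∀ d w m k → block d w (m + k) ≡ block d w m ++ block d (w + m) k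
  block-++ d w zero k = cong (λ v → block d v k) (sym (+-identityʳ w))
  block-++ d w (suc m) k = cong ((d , w) ∷_)
    (trans (block-++ d (suc w) m k) (cong (λ v → block d (suc w) m ++ block d v k) (sym (+-suc w m))))

  -- the multiset of statistics of the words h ∷ v, v ∈ insert± n w, when h sits at position i
  -- and h ∷ w has statistics (d , W) and a ascents
  insertionProfile : ℕ → ℕ × ℕ → ℕ → List (ℕ × ℕ)
  insertionProfile i (d , W) a =
    block d W (suc (2 * d)) ++ block (suc d) (W + suc (2 * i + 2 * d)) (suc (2 * a))

  module _ (n i : ℕ) (h x : ℤ) (w : List ℤ) (h≤n : Small n h) (x≤n : Small n x) where

    private
      d′ W′ a′ w₂ : ℕ
      d′ = desFrom (suc i) (x ∷ w)
      W′ = majFrom (suc i) (x ∷ w) + neg (x ∷ w)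
      a′ = ascents (x ∷ w)
      w₂ = W′ + suc (2 * suc i + 2 * d′)

      y₋ y₊ : ℕ × ℕ
      y₋ = stat i (h ∷ bottom n ∷ x ∷ w)
      y₊ = stat i (h ∷ top n ∷ x ∷ w)

      Tail Profile′ : List (ℕ × ℕ)
      Tail = map (λ v → stat (suc i) (x ∷ v)) (insert± n w)
      Profile′ = insertionProfile (suc i) (d′ , W′) a′

      y₋-stat : y₋ ≡ (suc d′ , 2 * i + negBit h + suc (2 * d′ + W′))
      y₋-stat = begin
        y₋                                                  ≡⟨ stat-descent i h (bottom n) (x ∷ w) (>ᵇbottom h h≤n) ⟩
        shiftStat 1 c (stat (suc i) (bottom n ∷ x ∷ w))     ≡⟨ cong (shiftStat 1 c) (stat-ascent (suc i) (bottom n) x w (bottom>ᵇ x x≤n)) ⟩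
        shiftStat 1 c (shiftStat 0 1 (stat (2 + i) (x ∷ w))) ≡⟨ cong (λ y → shiftStat 1 c (shiftStat 0 1 y)) (stat-suc (suc i) (x ∷ w)) ⟩
        (suc d′ , 2 * i + negBit h + suc (2 * d′ + W′))      ∎
        where
          open ≡-Reasoning
          c = 2 * i + negBit h

      y₊-stat : y₊ ≡ (suc d′ , negBit h + (2 * suc i + 0 + (2 * d′ + W′)))
      y₊-stat = begin
        y₊                                                  ≡⟨ stat-ascent i h (top n) (x ∷ w) (>ᵇtop h h≤n) ⟩
        shiftStat 0 b (stat (suc i) (top n ∷ x ∷ w))        ≡⟨ cong (shiftStat 0 b) (stat-descent (suc i) (top n) x w (top>ᵇ x x≤n)) ⟩
        shiftStat 0 b (shiftStat 1 c (stat (2 + i) (x ∷ w))) ≡⟨ cong (λ y → shiftStat 0 b (shiftStat 1 c y)) (stat-suc (suc i) (x ∷ w)) ⟩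
        (suc d′ , negBit h + (2 * suc i + 0 + (2 * d′ + W′))) ∎
        where
          open ≡-Reasoning
          b = negBit h
          c = 2 * suc i + 0

      -- in both cases the two new words fall between the two blocks of the shifted profile
      assemble : ∀ δ c → (∀ v → stat i (h ∷ x ∷ v) ≡ shiftStat δ c (stat (suc i) (x ∷ v))) → Tail ↭ Profile′ →
        map (λ v → stat i (h ∷ v)) (insert± n (x ∷ w)) ↭
        block (δ + d′) (c + W′) (suc (2 * d′)) ++ y₋ ∷ y₊ ∷ block (δ + suc d′) (c + w₂) (suc (2 * a′))
      assemble δ c shift ih = begin
        y₋ ∷ y₊ ∷ map (λ v → stat i (h ∷ v)) (map (x ∷_) (insert± n w))
          ≡⟨ cong (λ r → y₋ ∷ y₊ ∷ r) (trans (sym (map-∘ (insert± n w))) (trans (map-cong shift (insert± n w)) (map-∘ (insert± n w)))) ⟩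
        y₋ ∷ y₊ ∷ map (shiftStat δ c) Tail
          ↭⟨ prep y₋ (prep y₊ (map⁺ (shiftStat δ c) ih)) ⟩
        y₋ ∷ y₊ ∷ map (shiftStat δ c) Profile′
          ≡⟨ cong (λ r → y₋ ∷ y₊ ∷ r) (trans (map-++ (shiftStat δ c) (block d′ W′ m₁) (block (suc d′) w₂ m₂))
               (cong₂ _++_ (map-shiftStat-block δ c d′ W′ m₁) (map-shiftStat-block δ c (suc d′) w₂ m₂))) ⟩
        (y₋ ∷ y₊ ∷ []) ++ B₁ ++ B₂
          ↭⟨ shifts (y₋ ∷ y₊ ∷ []) B₁ ⟩
        B₁ ++ y₋ ∷ y₊ ∷ B₂ ∎
        where
          open PermutationReasoning
          m₁ = suc (2 * d′)
          m₂ = suc (2 * a′)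
          B₁ = block (δ + d′) (c + W′) m₁
          B₂ = block (δ + suc d′) (c + w₂) m₂

      insertion-descent : h >ᵇ x ≡ true → Tail ↭ Profile′ →
        map (λ v → stat i (h ∷ v)) (insert± n (x ∷ w)) ↭ insertionProfile i (stat i (h ∷ x ∷ w)) (ascents (h ∷ x ∷ w))
      insertion-descent h>x ih = begin
        map (λ v → stat i (h ∷ v)) (insert± n (x ∷ w))
          ↭⟨ assemble 1 c (λ v → stat-descent i h x v h>x) ih ⟩
        B₁ ++ y₋ ∷ y₊ ∷ block (suc (suc d′)) (c + w₂) m₂
          ≡⟨ cong₂ (λ y₋ y₊ → B₁ ++ y₋ ∷ y₊ ∷ block (suc (suc d′)) (c + w₂) m₂)
               (trans y₋-stat (cong (suc d′ ,_) (arith₋ i b d′ W′)))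
               (trans y₊-stat (cong (suc d′ ,_) (arith₊ i b d′ W′))) ⟩
        B₁ ++ block (suc d′) u 2 ++ block (suc (suc d′)) (c + w₂) m₂
          ≡⟨ sym (++-assoc B₁ _ _) ⟩
        (B₁ ++ block (suc d′) u 2) ++ block (suc (suc d′)) (c + w₂) m₂
          ≡⟨ cong₂ _++_ (sym (trans (cong (block (suc d′) (c + W′)) (arith₁ d′)) (block-++ (suc d′) (c + W′) (suc (2 * d′)) 2)))
                         (cong (λ v → block (suc (suc d′)) v m₂) (arith₂ i b d′ W′)) ⟩
        insertionProfile i (suc d′ , c + W′) a′
          ≡⟨ sym (cong₂ (insertionProfile i) (stat-descent i h x w h>x) (cong (λ b → if b then a′ else suc a′) h>x)) ⟩
        insertionProfile i (stat i (h ∷ x ∷ w)) (ascents (h ∷ x ∷ w)) ∎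
        where
          open PermutationReasoning
          b = negBit h
          c = 2 * i + b
          m₂ = suc (2 * a′)
          u = c + W′ + suc (2 * d′)
          B₁ = block (suc d′) (c + W′) (suc (2 * d′))
          arith₋ : ∀ i b d W → 2 * i + b + suc (2 * d + W) ≡ 2 * i + b + W + suc (2 * d)
          arith₋ = solve-∀
          arith₊ : ∀ i b d W → b + (2 * suc i + 0 + (2 * d + W)) ≡ suc (2 * i + b + W + suc (2 * d))
          arith₊ = solve-∀
          arith₁ : ∀ d → suc (2 * suc d) ≡ suc (2 * d) + 2
          arith₁ = solve-∀
          arith₂ : ∀ i b d W → 2 * i + b + (W + suc (2 * suc i + 2 * d)) ≡ 2 * i + b + W + suc (2 * i + 2 * suc d)
          arith₂ = solve-∀

      insertion-ascent : h >ᵇ x ≡ false → Tail ↭ Profile′ →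
        map (λ v → stat i (h ∷ v)) (insert± n (x ∷ w)) ↭ insertionProfile i (stat i (h ∷ x ∷ w)) (ascents (h ∷ x ∷ w))
      insertion-ascent h≯x ih = begin
        map (λ v → stat i (h ∷ v)) (insert± n (x ∷ w))
          ↭⟨ assemble 0 b (λ v → stat-ascent i h x v h≯x) ih ⟩
        B₁ ++ y₋ ∷ y₊ ∷ block (suc d′) (b + w₂) (suc (2 * a′))
          ≡⟨ cong (B₁ ++_) (cong₂ (λ y₋ y₊ → y₋ ∷ y₊ ∷ block (suc d′) (b + w₂) (suc (2 * a′)))
               (trans y₋-stat (cong (suc d′ ,_) (arith₋ i b d′ W′)))
               (trans y₊-stat (cong (suc d′ ,_) (arith₊ i b d′ W′)))) ⟩
        B₁ ++ (suc d′ , u) ∷ (suc d′ , suc u) ∷ block (suc d′) (b + w₂) (suc (2 * a′))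
          ≡⟨ cong (B₁ ++_) (trans (cong (λ v → (suc d′ , u) ∷ (suc d′ , suc u) ∷ block (suc d′) v (suc (2 * a′))) (arith₂ i b d′ W′))
                                  (cong (block (suc d′) u) (arith₁ a′))) ⟩
        insertionProfile i (d′ , b + W′) (suc a′)
          ≡⟨ sym (cong₂ (insertionProfile i) (stat-ascent i h x w h≯x) (cong (λ b → if b then a′ else suc a′) h≯x)) ⟩
        insertionProfile i (stat i (h ∷ x ∷ w)) (ascents (h ∷ x ∷ w)) ∎
        where
          open PermutationReasoning
          b = negBit h
          u = b + W′ + suc (2 * i + 2 * d′)
          B₁ = block d′ (b + W′) (suc (2 * d′))
          arith₋ : ∀ i b d W → 2 * i + b + suc (2 * d + W) ≡ b + W + suc (2 * i + 2 * d)
          arith₋ = solve-∀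
          arith₊ : ∀ i b d W → b + (2 * suc i + 0 + (2 * d + W)) ≡ suc (b + W + suc (2 * i + 2 * d))
          arith₊ = solve-∀
          arith₁ : ∀ a → suc (suc (suc (2 * a))) ≡ suc (2 * suc a)
          arith₁ = solve-∀
          arith₂ : ∀ i b d W → b + (W + suc (2 * suc i + 2 * d)) ≡ suc (suc (b + W + suc (2 * i + 2 * d)))
          arith₂ = solve-∀

    insertion-step : Tail ↭ Profile′ →
      map (λ v → stat i (h ∷ v)) (insert± n (x ∷ w)) ↭ insertionProfile i (stat i (h ∷ x ∷ w)) (ascents (h ∷ x ∷ w))
    insertion-step ih = by-cases (h >ᵇ x) refl
      where
        by-cases : ∀ b → h >ᵇ x ≡ b →
          map (λ v → stat i (h ∷ v)) (insert± n (x ∷ w)) ↭ insertionProfile i (stat i (h ∷ x ∷ w)) (ascents (h ∷ x ∷ w))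
        by-cases true h>x = insertion-descent h>x ih
        by-cases false h≯x = insertion-ascent h≯x ih

  stat-insert± : ∀ n i h w → Small n h → All (Small n) w →
    map (λ v → stat i (h ∷ v)) (insert± n w) ↭ insertionProfile i (stat i (h ∷ w)) (ascents (h ∷ w))
  stat-insert± n i h [] h≤n [] = begin
    stat i (h ∷ bottom n ∷ []) ∷ stat i (h ∷ top n ∷ []) ∷ []
      ↭⟨ swap _ _ refl ⟩
    stat i (h ∷ top n ∷ []) ∷ stat i (h ∷ bottom n ∷ []) ∷ []
      ≡⟨ cong₂ (λ y₊ y₋ → y₊ ∷ y₋ ∷ []) y₊-stat y₋-stat ⟩
    insertionProfile i (stat i (h ∷ [])) 0 ∎
    where
      open PermutationReasoning
      W = neg (h ∷ [])
      y₊-stat : stat i (h ∷ top n ∷ []) ≡ (0 , W)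
      y₊-stat = trans (stat-ascent i h (top n) [] (>ᵇtop h h≤n)) (cong (0 ,_) (sym (neg-∷ h [])))
      y₋-stat : stat i (h ∷ bottom n ∷ []) ≡ (1 , W + suc (2 * i + 0))
      y₋-stat = trans (stat-descent i h (bottom n) [] (>ᵇbottom h h≤n))
        (cong (1 ,_) (trans (arith i (negBit h)) (cong (_+ suc (2 * i + 0)) (sym (neg-∷ h [])))))
        where
          arith : ∀ i b → 2 * i + b + (0 + 1) ≡ b + 0 + suc (2 * i + 0)
          arith = solve-∀
  stat-insert± n i h (x ∷ w) h≤n (x≤n ∷ w≤n) =
    insertion-step n i h x w h≤n x≤n (stat-insert± n (suc i) x w x≤n w≤n)

module Enumeration where

  open Insertion
  open import Function using (_∘_; _⇔_; mk⇔; Equivalence)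
  open import Data.Empty using (⊥-elim)
  open import Data.Unit using (tt)
  open import Data.Nat using (ℕ; zero; suc; _≤_; _<_; z≤n; s≤s; _≡ᵇ_; _≟_; pred)
  open import Data.Nat.Properties using (≡ᵇ⇒≡; ≡⇒≡ᵇ; ≤-reflexive; ≤-trans; ≤-pred; ≤∧≢⇒<; <-irrefl; m≤n⇒m≤1+n; suc-injective)
  open import Data.Integer using (ℤ; -[1+_]; ∣_∣)
  open import Data.Bool using (true; false; if_then_else_; T; T?)
  open import Data.Bool.Properties using (T-∧; T-not-≡)
  open import Data.List using (List; []; _∷_; map; concatMap; length; _++_; upTo)
  open import Data.List.Properties using (length-map)
  open import Data.List.Relation.Unary.All as All using (All; []; _∷_)
  open import Data.List.Relation.Unary.All.Properties using (¬Any⇒All¬; All¬⇒¬Any; ++⁻ˡ) renaming (map⁺ to All-map⁺; map⁻ to All-map⁻)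
  open import Data.List.Relation.Unary.Any using (Any; here; there; any?)
  open import Data.List.Relation.Unary.Unique.Propositional using (Unique; []; _∷_)
  import Data.List.Relation.Unary.Unique.Propositional.Properties as Unique
  open import Data.List.Membership.Propositional using (_∈_; _∉_; find; lose)
  open import Data.List.Membership.Propositional.Properties
    using (∈-map⁺; ∈-map⁻; ∈-concatMap⁺; ∈-concatMap⁻; ∈-upTo⁺; ∈-upTo⁻; ∈-filter⁺; ∈-filter⁻; ∈-∃++)
  open import Data.List.Membership.Propositional.Properties.WithK using (unique∧set⇒bag)
  open import Data.List.Relation.Binary.BagAndSetEquality using (∼bag⇒↭)
  open import Data.List.Relation.Binary.Permutation.Propositional using (_↭_; ↭-sym; ↭⇒↭ₛ)
  open import Data.List.Relation.Binary.Permutation.Propositional.Properties using (All-resp-↭; ↭-length; shift) renaming (map⁺ to ↭-map⁺)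
  open import Data.Product using (∃; _×_; _,_; proj₁; proj₂)
  open import Relation.Nullary using (¬_; yes; no)
  open import Relation.Nullary.Decidable using (dec-true; dec-false)
  open import Relation.Binary.PropositionalEquality
  open import Data.List.Relation.Binary.Permutation.Setoid.Properties (setoid ℕ) using (Unique-resp-↭)

  elemᵇ⇒∈ : ∀ x ys → T (elemᵇ x ys) → x ∈ ys
  elemᵇ⇒∈ x (y ∷ ys) = cases (x ≡ᵇ y) refl
    where
      cases : ∀ b → (x ≡ᵇ y) ≡ b → T (if b then true else elemᵇ x ys) → x ∈ y ∷ ys
      cases true x≡y _ = here (≡ᵇ⇒≡ x y (subst T (sym x≡y) tt))
      cases false _ t = there (elemᵇ⇒∈ x ys t)

  ∈⇒elemᵇ : ∀ x ys → x ∈ ys → T (elemᵇ x ys)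
  ∈⇒elemᵇ x (y ∷ ys) = cases (x ≡ᵇ y) refl
    where
      cases : ∀ b → (x ≡ᵇ y) ≡ b → x ∈ y ∷ ys → T (if b then true else elemᵇ x ys)
      cases true _ _ = tt
      cases false x≢y (here refl) = ⊥-elim (subst T x≢y (≡⇒≡ᵇ x x refl))
      cases false _ (there x∈ys) = ∈⇒elemᵇ x ys x∈ys

  distinctᵇ⇔Unique : ∀ xs → T (distinctᵇ xs) ⇔ Unique xs
  distinctᵇ⇔Unique [] = mk⇔ (λ _ → []) (λ _ → tt)
  distinctᵇ⇔Unique (x ∷ xs) = mk⇔
    (λ t → let x∉ , u = Equivalence.to T-∧ t in
      ¬Any⇒All¬ xs (λ x∈ → subst T (Equivalence.to T-not-≡ x∉) (∈⇒elemᵇ x xs x∈))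
      ∷ Equivalence.to (distinctᵇ⇔Unique xs) u)
    (λ { (x∉ ∷ u) → Equivalence.from T-∧
      ( Equivalence.from T-not-≡ (not-elem (elemᵇ x xs) refl (All¬⇒¬Any x∉))
      , Equivalence.from (distinctᵇ⇔Unique xs) u) })
    where
      not-elem : ∀ b → elemᵇ x xs ≡ b → x ∉ xs → b ≡ false
      not-elem true e x∉ = ⊥-elim (x∉ (elemᵇ⇒∈ x xs (subst T (sym e) tt)))
      not-elem false _ _ = refl

  unique-concatMap : ∀ {A B : Set} (f : A → List B) (g : B → A) {xs} → Unique xs →
    (∀ {x} → x ∈ xs → Unique (f x)) → (∀ {x v} → x ∈ xs → v ∈ f x → g v ≡ x) →
    Unique (concatMap f xs)
  unique-concatMap f g {[]} [] _ _ = []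
  unique-concatMap f g {x ∷ xs} (x∉ ∷ u) unique-f g∘f =
    Unique.++⁺ (unique-f (here refl)) (unique-concatMap f g u (unique-f ∘ there) (g∘f ∘ there)) disjoint
    where
      disjoint : ∀ {v} → ¬ (v ∈ f x × v ∈ concatMap f xs)
      disjoint (v∈fx , v∈rest) with y , y∈xs , v∈fy ← find (∈-concatMap⁻ f {xs = xs} v∈rest) =
        All.lookup x∉ y∈xs (trans (sym (g∘f (here refl) v∈fx)) (g∘f (there y∈xs) v∈fy))

  length-unique-≤ : ∀ N (xs : List ℕ) → Unique xs → All (λ a → 0 < a × a ≤ N) xs → length xs ≤ N
  length-unique-≤ zero [] _ _ = z≤n
  length-unique-≤ zero (x ∷ xs) _ ((0<x , x≤0) ∷ _) with () ← ≤-trans 0<x x≤0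
  length-unique-≤ (suc N) xs u bounds = ≤-trans (length-remove xs u) (s≤s
    (length-unique-≤ N (remove xs) (unique-remove xs u) (bounds-remove xs bounds)))
    where
      remove : List ℕ → List ℕ
      remove [] = []
      remove (x ∷ xs) with x ≟ suc N
      ... | yes _ = remove xs
      ... | no _ = x ∷ remove xs

      all-remove : ∀ {P : ℕ → Set} xs → All P xs → All P (remove xs)
      all-remove [] [] = []
      all-remove (x ∷ xs) (px ∷ pxs) with x ≟ suc N
      ... | yes _ = all-remove xs pxs
      ... | no _ = px ∷ all-remove xs pxs

      unique-remove : ∀ xs → Unique xs → Unique (remove xs)
      unique-remove [] [] = []
      unique-remove (x ∷ xs) (x∉ ∷ u) with x ≟ suc N
      ... | yes _ = unique-remove xs u
      ... | no _ = all-remove xs x∉ ∷ unique-remove xs u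

      bounds-remove : ∀ xs → All (λ a → 0 < a × a ≤ suc N) xs → All (λ a → 0 < a × a ≤ N) (remove xs)
      bounds-remove [] [] = []
      bounds-remove (x ∷ xs) ((0<x , x≤1+N) ∷ bs) with x ≟ suc N
      ... | yes _ = bounds-remove xs bs
      ... | no x≢1+N = (0<x , ≤-pred (≤∧≢⇒< x≤1+N x≢1+N)) ∷ bounds-remove xs bs

      length-remove-absent : ∀ xs → All (suc N ≢_) xs → length (remove xs) ≡ length xs
      length-remove-absent [] [] = refl
      length-remove-absent (x ∷ xs) (p ∷ ps) with x ≟ suc N
      ... | yes x≡1+N = ⊥-elim (p (sym x≡1+N))
      ... | no _ = cong suc (length-remove-absent xs ps)

      length-remove : ∀ xs → Unique xs → length xs ≤ suc (length (remove xs))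
      length-remove [] [] = z≤n
      length-remove (x ∷ xs) (x∉ ∷ u) with x ≟ suc N
      ... | yes refl = s≤s (≤-reflexive (sym (length-remove-absent xs x∉)))
      ... | no _ = s≤s (length-remove xs u)

  record Letter (m : ℕ) (x : ℤ) : Set where
    constructor letter
    field
      nonzero : 0 < ∣ x ∣
      small : Small m x

  private
    letters : ℕ → List ℤ
    letters i = ℤ.+ suc i ∷ -[1+ i ] ∷ []

  ∈-alphabet⁻ : ∀ {m x} → x ∈ alphabet m → Letter m x
  ∈-alphabet⁻ {m} x∈ with find (∈-concatMap⁻ letters {xs = upTo m} x∈)
  ... | i , i∈ , here refl = letter (s≤s z≤n) (∈-upTo⁻ i∈)
  ... | i , i∈ , there (here refl) = letter (s≤s z≤n) (∈-upTo⁻ i∈)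

  ∈-alphabet⁺ : ∀ {m x} → Letter m x → x ∈ alphabet m
  ∈-alphabet⁺ {m} {ℤ.+ suc i} (letter _ i<m) = ∈-concatMap⁺ letters {xs = upTo m} (lose (∈-upTo⁺ i<m) (here refl))
  ∈-alphabet⁺ {m} { -[1+ i ]} (letter _ i<m) = ∈-concatMap⁺ letters {xs = upTo m} (lose (∈-upTo⁺ i<m) (there (here refl)))

  unique-alphabet : ∀ m → Unique (alphabet m)
  unique-alphabet m = unique-concatMap letters (pred ∘ ∣_∣) (Unique.upTo⁺ m)
    (λ _ → ((λ ()) ∷ []) ∷ [] ∷ [])
    (λ { _ (here refl) → refl ; _ (there (here refl)) → refl })

  ∈-words⁻ : ∀ N m {w} → w ∈ words N m → length w ≡ m × All (_∈ alphabet N) w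
  ∈-words⁻ N zero (here refl) = refl , []
  ∈-words⁻ N (suc m) w∈
    with a , a∈ , w∈aws ← find (∈-concatMap⁻ (λ a → map (a ∷_) (words N m)) {xs = alphabet N} w∈)
    with w′ , w′∈ , refl ← ∈-map⁻ (a ∷_) w∈aws
    with len , letters ← ∈-words⁻ N m w′∈
    = cong suc len , a∈ ∷ letters

  ∈-words⁺ : ∀ N m {w} → length w ≡ m → All (_∈ alphabet N) w → w ∈ words N m
  ∈-words⁺ N zero {[]} refl [] = here refl
  ∈-words⁺ N (suc m) {a ∷ w} len (a∈ ∷ w∈) =
    ∈-concatMap⁺ (λ a → map (a ∷_) (words N m)) {xs = alphabet N}
      (lose a∈ (∈-map⁺ (a ∷_) (∈-words⁺ N m (suc-injective len) w∈)))

  unique-words : ∀ N m → Unique (words N m)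
  unique-words N zero = [] ∷ []
  unique-words N (suc m) =
    unique-concatMap (λ a → map (a ∷_) (words N m)) head (unique-alphabet N)
      (λ _ → Unique.map⁺ (λ { refl → refl }) (unique-words N m))
      (λ {a} _ v∈ → head-∷ a v∈)
    where
      head : List ℤ → ℤ
      head [] = ℤ.+ 0
      head (x ∷ _) = x
      head-∷ : ∀ a {v} → v ∈ map (a ∷_) (words N m) → head v ≡ a
      head-∷ a v∈ with _ , _ , refl ← ∈-map⁻ (a ∷_) v∈ = refl

  IsSignedPerm : ℕ → List ℤ → Set
  IsSignedPerm m w = length w ≡ m × All (Letter m) w × Unique (map ∣_∣ w)

  ∈-signedPerms⁻ : ∀ m {w} → w ∈ signedPerms m → IsSignedPerm m w
  ∈-signedPerms⁻ m w∈
    with w∈words , distinct ← ∈-filter⁻ (T? ∘ isSignedPermᵇ) {xs = words m m} w∈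
    with len , letters ← ∈-words⁻ m m w∈words
    = len , All.map ∈-alphabet⁻ letters , Equivalence.to (distinctᵇ⇔Unique _) distinct

  ∈-signedPerms⁺ : ∀ m {w} → IsSignedPerm m w → w ∈ signedPerms m
  ∈-signedPerms⁺ m (len , letters , u) =
    ∈-filter⁺ (T? ∘ isSignedPermᵇ) {xs = words m m}
      (∈-words⁺ m m len (All.map ∈-alphabet⁺ letters)) (Equivalence.from (distinctᵇ⇔Unique _) u)

  unique-signedPerms : ∀ m → Unique (signedPerms m)
  unique-signedPerms m = Unique.filter⁺ (T? ∘ isSignedPermᵇ) (unique-words m m)

  signedPerm-small : ∀ {m w} → w ∈ signedPerms m → All (Small m) w
  signedPerm-small {m} w∈ = All.map Letter.small (proj₁ (proj₂ (∈-signedPerms⁻ m w∈)))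

  ∈-insert±⁻ : ∀ n w {v} → v ∈ insert± n w →
    ∃ λ pre → ∃ λ post → ∃ λ s → w ≡ pre ++ post × v ≡ pre ++ s ∷ post × ∣ s ∣ ≡ suc n
  ∈-insert±⁻ n [] (here refl) = [] , [] , bottom n , refl , refl , refl
  ∈-insert±⁻ n [] (there (here refl)) = [] , [] , top n , refl , refl , refl
  ∈-insert±⁻ n (x ∷ w) (here refl) = [] , x ∷ w , bottom n , refl , refl , refl
  ∈-insert±⁻ n (x ∷ w) (there (here refl)) = [] , x ∷ w , top n , refl , refl , refl
  ∈-insert±⁻ n (x ∷ w) (there (there v∈))
    with v′ , v′∈ , refl ← ∈-map⁻ (x ∷_) v∈
    with pre , post , s , refl , refl , s≡ ← ∈-insert±⁻ n w v′∈
    = x ∷ pre , post , s , refl , refl , s≡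

  ∈-insert±⁺ : ∀ n pre post s → ∣ s ∣ ≡ suc n → pre ++ s ∷ post ∈ insert± n (pre ++ post)
  ∈-insert±⁺ n [] [] -[1+ _ ] refl = here refl
  ∈-insert±⁺ n [] [] (ℤ.+ _) refl = there (here refl)
  ∈-insert±⁺ n [] (x ∷ post) -[1+ _ ] refl = here refl
  ∈-insert±⁺ n [] (x ∷ post) (ℤ.+ _) refl = there (here refl)
  ∈-insert±⁺ n (x ∷ pre) post s s≡ = there (there (∈-map⁺ (x ∷_) (∈-insert±⁺ n pre post s s≡)))

  unique-insert± : ∀ n {w} → All (Small n) w → Unique (insert± n w)
  unique-insert± n [] = ((λ ()) ∷ []) ∷ [] ∷ []
  unique-insert± n {x ∷ w} (x≤n ∷ w≤n) =
    ((λ ()) ∷ All-map⁺ (All.universal (λ v → differentHead λ { refl → <-irrefl refl x≤n }) _))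
    ∷ All-map⁺ (All.universal (λ v → differentHead λ { refl → <-irrefl refl x≤n }) _)
    ∷ Unique.map⁺ (λ { refl → refl }) (unique-insert± n w≤n)
    where
      differentHead : ∀ {a b : ℤ} {u v : List ℤ} → a ≢ b → _≢_ {A = List ℤ} (a ∷ u) (b ∷ v)
      differentHead a≢b refl = a≢b refl

  delete± : ℕ → List ℤ → List ℤ
  delete± n [] = []
  delete± n (x ∷ w) = if ∣ x ∣ ≡ᵇ suc n then w else x ∷ delete± n w

  delete±-insert : ∀ n pre post s → All (Small n) pre → ∣ s ∣ ≡ suc n → delete± n (pre ++ s ∷ post) ≡ pre ++ post
  delete±-insert n [] post s [] s≡ rewrite s≡ | dec-true (n ≟ n) refl = refl
  delete±-insert n (x ∷ pre) post s (x≤n ∷ pre≤n) s≡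
    rewrite dec-false (∣ x ∣ ≟ suc n) (λ x≡ → <-irrefl x≡ (s≤s x≤n)) = cong (x ∷_) (delete±-insert n pre post s pre≤n s≡)

  IsSignedPerm-resp-↭ : ∀ {m w w′} → w ↭ w′ → IsSignedPerm m w → IsSignedPerm m w′
  IsSignedPerm-resp-↭ p (len , letters , u) =
    trans (sym (↭-length p)) len , All-resp-↭ p letters , Unique-resp-↭ (↭⇒↭ₛ (↭-map⁺ ∣_∣ p)) u

  IsSignedPerm-∷ : ∀ {n s π} → ∣ s ∣ ≡ suc n → IsSignedPerm (suc n) (s ∷ π) ⇔ IsSignedPerm n π
  IsSignedPerm-∷ {n} {s} {π} s≡ = mk⇔
    (λ { (len , _ ∷ letters , s∉ ∷ u) →
         suc-injective len , All.zipWith lower (letters , All-map⁻ s∉) , u })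
    (λ (len , letters , u) →
         cong suc len , letter (subst (0 <_) (sym s≡) (s≤s z≤n)) (≤-reflexive s≡) ∷ All.map raise letters
       , All-map⁺ (All.map (λ (letter _ x≤n) x≡ → <-irrefl (trans (sym x≡) s≡) (s≤s x≤n)) letters) ∷ u)
    where
      lower : ∀ {x} → Letter (suc n) x × ∣ s ∣ ≢ ∣ x ∣ → Letter n x
      lower (letter 0<x x≤1+n , s≢x) = letter 0<x (≤-pred (≤∧≢⇒< x≤1+n (λ x≡ → s≢x (trans s≡ (sym x≡)))))
      raise : ∀ {x} → Letter n x → Letter (suc n) x
      raise (letter 0<x x≤n) = letter 0<x (m≤n⇒m≤1+n x≤n)

  signedPerm-∋-max : ∀ {n v} → IsSignedPerm (suc n) v → Any (λ x → ∣ x ∣ ≡ suc n) v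
  signedPerm-∋-max {n} {v} (len , letters , u) with any? (λ x → ∣ x ∣ ≟ suc n) v
  ... | yes found = found
  ... | no none = ⊥-elim (<-irrefl refl (subst (_≤ n) (trans (length-map ∣_∣ v) len)
        (length-unique-≤ n (map ∣_∣ v) u (All-map⁺ (All.zipWith below (letters , ¬Any⇒All¬ v none))))))
    where
      below : ∀ {x} → Letter (suc n) x × ∣ x ∣ ≢ suc n → 0 < ∣ x ∣ × ∣ x ∣ ≤ n
      below (letter 0<x x≤1+n , x≢) = 0<x , ≤-pred (≤∧≢⇒< x≤1+n x≢)

  insertions : ℕ → List (List ℤ)
  insertions n = concatMap (insert± n) (signedPerms n)

  insertions⊆signedPerms : ∀ n {v} → v ∈ insertions n → v ∈ signedPerms (suc n)
  insertions⊆signedPerms n v∈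
    with π , π∈ , v∈insert ← find (∈-concatMap⁻ (insert± n) {xs = signedPerms n} v∈)
    with pre , post , s , refl , refl , s≡ ← ∈-insert±⁻ n π v∈insert
    = ∈-signedPerms⁺ (suc n) (IsSignedPerm-resp-↭ (↭-sym (shift s pre post))
        (Equivalence.from (IsSignedPerm-∷ s≡) (∈-signedPerms⁻ n π∈)))

  signedPerms⊆insertions : ∀ n {v} → v ∈ signedPerms (suc n) → v ∈ insertions n
  signedPerms⊆insertions n {v} v∈
    with s , s∈ , s≡ ← find (signedPerm-∋-max (∈-signedPerms⁻ (suc n) v∈))
    with pre , post , refl ← ∈-∃++ s∈
    = ∈-concatMap⁺ (insert± n) {xs = signedPerms n}
        (lose (∈-signedPerms⁺ n (Equivalence.to (IsSignedPerm-∷ s≡)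
                 (IsSignedPerm-resp-↭ (shift s pre post) (∈-signedPerms⁻ (suc n) v∈))))
              (∈-insert±⁺ n pre post s s≡))

  unique-insertions : ∀ n → Unique (insertions n)
  unique-insertions n = unique-concatMap (insert± n) (delete± n) (unique-signedPerms n)
    (λ π∈ → unique-insert± n (signedPerm-small π∈))
    (λ {π} π∈ v∈ → deleted π (signedPerm-small π∈) v∈)
    where
      deleted : ∀ π → All (Small n) π → ∀ {v} → v ∈ insert± n π → delete± n v ≡ π
      deleted π π≤n v∈ with pre , post , s , refl , refl , s≡ ← ∈-insert±⁻ n π v∈ =
        delete±-insert n pre post s (++⁻ˡ pre π≤n) s≡

  signedPerms-suc : ∀ n → signedPerms (suc n) ↭ insertions n
  signedPerms-suc n = ∼bag⇒↭ (unique∧set⇒bag (unique-signedPerms (suc n)) (unique-insertions n)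
    (mk⇔ (signedPerms⊆insertions n) (insertions⊆signedPerms n)))

module Identity {c ℓ : Level} (R : CommutativeRing c ℓ) (q q⁻¹ : CommutativeRing.Carrier R) where

  open Insertion
  open Enumeration
  open import Function using (_∘_)
  open import Data.Nat using (ℕ; zero; suc; _∸_; _≤_; _<_; _≡ᵇ_; z≤n; s≤s)
  import Data.Nat.Properties as ℕ
  import Data.Nat.Tactic.RingSolver as ℕ-Solver
  open import Data.Integer using (ℤ; _⊖_)
  import Data.Integer.Properties as ℤ
  import Data.Integer.Tactic.RingSolver as ℤ-Solver
  open import Data.Bool using (Bool; true; false; if_then_else_; T)
  open import Data.Unit using (tt)
  open import Data.Product using (_×_; _,_; proj₁; proj₂)
  open import Data.List using (List; []; _∷_; map; concatMap; filterᵇ; _++_; upTo; applyUpTo)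
  open import Data.List.Properties using (map-++; map-∘)
  open import Data.List.Membership.Propositional using (_∈_)
  open import Data.List.Relation.Unary.All using (All)
  open import Data.List.Relation.Unary.Any using (here; there)
  open import Data.List.Relation.Binary.Permutation.Propositional using (_↭_; ↭⇒↭ₛ′)
  open import Data.List.Relation.Binary.Permutation.Propositional.Properties using () renaming (map⁺ to ↭-map⁺)
  import Data.List.Relation.Binary.Permutation.Setoid.Properties as PermutationProperties
  open import Relation.Nullary using (yes; no)

  open CommutativeRing R hiding (zero)
  open QAnalogues R q q⁻¹
  open import Relation.Binary.Reasoning.Setoid setoid
  open import Algebra.Solver.Ring.NaturalCoefficients.Default commutativeSemiring
    using (solve; _:=_; _:+_; _:*_; con)

  sumR-↭ : ∀ {xs ys} → xs ↭ ys → sumR xs ≈ sumR ys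
  sumR-↭ p = PermutationProperties.foldr-commMonoid setoid +-isCommutativeMonoid (↭⇒↭ₛ′ isEquivalence p)

  sumR-++ : ∀ xs ys → sumR (xs ++ ys) ≈ sumR xs + sumR ys
  sumR-++ [] ys = sym (+-identityˡ _)
  sumR-++ (x ∷ xs) ys = trans (+-congˡ (sumR-++ xs ys)) (sym (+-assoc _ _ _))

  sumR-concatMap : ∀ {A B : Set} (f : B → Carrier) (g : A → List B) xs →
    sumR (map f (concatMap g xs)) ≈ sumR (map (λ x → sumR (map f (g x))) xs)
  sumR-concatMap f g [] = refl
  sumR-concatMap f g (x ∷ xs) = begin
    sumR (map f (g x ++ concatMap g xs))                ≡⟨ ≡.cong sumR (map-++ f (g x) _) ⟩
    sumR (map f (g x) ++ map f (concatMap g xs))        ≈⟨ sumR-++ (map f (g x)) _ ⟩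
    sumR (map f (g x)) + sumR (map f (concatMap g xs))  ≈⟨ +-congˡ (sumR-concatMap f g xs) ⟩
    sumR (map (λ x → sumR (map f (g x))) (x ∷ xs))      ∎

  sumR-cong : ∀ {A : Set} {f g : A → Carrier} xs → (∀ {x} → x ∈ xs → f x ≈ g x) → sumR (map f xs) ≈ sumR (map g xs)
  sumR-cong [] _ = refl
  sumR-cong (x ∷ xs) f≈g = +-cong (f≈g (here ≡.refl)) (sumR-cong xs (f≈g ∘ there))

  sumR-+ : ∀ {A : Set} (f g : A → Carrier) xs → sumR (map (λ x → f x + g x) xs) ≈ sumR (map f xs) + sumR (map g xs)
  sumR-+ f g [] = sym (+-identityˡ 0#)
  sumR-+ f g (x ∷ xs) = trans (+-congˡ (sumR-+ f g xs))
    (solve 4 (λ a b c d → (a :+ b) :+ (c :+ d) := (a :+ c) :+ (b :+ d)) refl (f x) (g x) _ _)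

  *-sumR : ∀ {A : Set} a (f : A → Carrier) xs → a * sumR (map f xs) ≈ sumR (map (λ x → a * f x) xs)
  *-sumR a f [] = zeroʳ a
  *-sumR a f (x ∷ xs) = trans (distribˡ a (f x) _) (+-congˡ (*-sumR a f xs))

  sumR-filterᵇ : ∀ {A : Set} (f : A → Carrier) (p : A → Bool) xs →
    sumR (map f (filterᵇ p xs)) ≈ sumR (map (λ x → if p x then f x else 0#) xs)
  sumR-filterᵇ f p [] = refl
  sumR-filterᵇ f p (x ∷ xs) with p x
  ... | true = +-congˡ (sumR-filterᵇ f p xs)
  ... | false = trans (sumR-filterᵇ f p xs) (sym (+-identityˡ _))

  ∑ : ℕ → (ℕ → Carrier) → Carrier
  ∑ zero f = 0#
  ∑ (suc m) f = f 0 + ∑ m (f ∘ suc)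

  syntax ∑ m (λ i → e) = ∑[ i < m ] e

  sumR-upTo : ∀ (f : ℕ → Carrier) m → sumR (map f (upTo m)) ≡.≡ ∑ m f
  sumR-upTo f m = go f (λ i → i) m
    where
      go : ∀ (f : ℕ → Carrier) g m → sumR (map f (applyUpTo g m)) ≡.≡ ∑ m (f ∘ g)
      go f g zero = ≡.refl
      go f g (suc m) = ≡.cong (λ s → f (g 0) + s) (go f (g ∘ suc) m)

  ∑-cong : ∀ {f g} m → (∀ i → i < m → f i ≈ g i) → ∑ m f ≈ ∑ m g
  ∑-cong zero f≈g = refl
  ∑-cong (suc m) f≈g = +-cong (f≈g 0 (s≤s z≤n)) (∑-cong m (λ i i<m → f≈g (suc i) (s≤s i<m)))

  ∑-+ : ∀ f g m → ∑[ i < m ] (f i + g i) ≈ ∑ m f + ∑ m g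
  ∑-+ f g zero = sym (+-identityˡ 0#)
  ∑-+ f g (suc m) = trans (+-congˡ (∑-+ (f ∘ suc) (g ∘ suc) m))
    (solve 4 (λ a b c d → (a :+ b) :+ (c :+ d) := (a :+ c) :+ (b :+ d)) refl (f 0) (g 0) _ _)

  *-∑ : ∀ a f m → a * ∑ m f ≈ ∑[ i < m ] (a * f i)
  *-∑ a f zero = zeroʳ a
  *-∑ a f (suc m) = trans (distribˡ a (f 0) _) (+-congˡ (*-∑ a (f ∘ suc) m))

  ∑-last : ∀ f m → ∑ (suc m) f ≈ ∑ m f + f m
  ∑-last f zero = trans (+-identityʳ (f 0)) (sym (+-identityˡ (f 0)))
  ∑-last f (suc m) = trans (+-congˡ (∑-last (f ∘ suc) m)) (sym (+-assoc _ _ _))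

  ∑-zero : ∀ f m → (∀ i → i < m → f i ≈ 0#) → ∑ m f ≈ 0#
  ∑-zero f m f≈0 = trans (∑-cong m f≈0) (zero-sum m)
    where
      zero-sum : ∀ m → ∑[ i < m ] 0# ≈ 0#
      zero-sum zero = refl
      zero-sum (suc m) = trans (+-identityˡ _) (zero-sum m)

  ^-cong : ∀ {x y} a → x ≈ y → x ^ a ≈ y ^ a
  ^-cong zero _ = refl
  ^-cong (suc a) x≈y = *-cong x≈y (^-cong a x≈y)

  ^-+ : ∀ x a b → x ^ (a ℕ.+ b) ≈ x ^ a * x ^ b
  ^-+ x zero b = sym (*-identityˡ _)
  ^-+ x (suc a) b = trans (*-congˡ (^-+ x a b)) (sym (*-assoc _ _ _))

  ^-distrib-* : ∀ x y a → (x * y) ^ a ≈ x ^ a * y ^ a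
  ^-distrib-* x y zero = sym (*-identityˡ 1#)
  ^-distrib-* x y (suc a) = trans (*-congˡ (^-distrib-* x y a))
    (solve 4 (λ x y a b → (x :* y) :* (a :* b) := (x :* a) :* (y :* b)) refl x y _ _)

  1^ : ∀ a → 1# ^ a ≈ 1#
  1^ zero = refl
  1^ (suc a) = trans (*-identityˡ _) (1^ a)

  square^ : ∀ x a → (x * x) ^ a ≈ x ^ (2 ℕ.* a)
  square^ x a = begin
    (x * x) ^ a        ≈⟨ ^-distrib-* x x a ⟩
    x ^ a * x ^ a      ≈⟨ sym (^-+ x a a) ⟩
    x ^ (a ℕ.+ a)      ≡⟨ ≡.cong (λ b → x ^ (a ℕ.+ b)) (≡.sym (ℕ.+-identityʳ a)) ⟩
    x ^ (2 ℕ.* a)      ∎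

  qint-suc : ∀ x m → qint x (suc m) ≈ 1# + x * qint x m
  qint-suc x m = begin
    qint x (suc m)                ≡⟨ sumR-upTo (x ^_) (suc m) ⟩
    1# + ∑[ i < m ] (x * x ^ i)   ≈⟨ +-congˡ (sym (*-∑ x (x ^_) m)) ⟩
    1# + x * ∑ m (x ^_)           ≡⟨ ≡.cong (λ s → 1# + x * s) (≡.sym (sumR-upTo (x ^_) m)) ⟩
    1# + x * qint x m             ∎

  qint-1 : ∀ x → qint x 1 ≈ 1#
  qint-1 x = +-identityʳ 1#

  qint-+ : ∀ x a b → qint x (a ℕ.+ b) ≈ qint x a + x ^ a * qint x b
  qint-+ x zero b = sym (trans (+-identityˡ _) (*-identityˡ _))
  qint-+ x (suc a) b = begin
    qint x (suc (a ℕ.+ b))                    ≈⟨ qint-suc x (a ℕ.+ b) ⟩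
    1# + x * qint x (a ℕ.+ b)                 ≈⟨ +-congˡ (*-congˡ (qint-+ x a b)) ⟩
    1# + x * (qint x a + x ^ a * qint x b)
      ≈⟨ solve 4 (λ o x a b → o :+ x :* (a :+ b) := (o :+ x :* a) :+ x :* b) refl 1# x (qint x a) (x ^ a * qint x b) ⟩
    (1# + x * qint x a) + x * (x ^ a * qint x b) ≈⟨ +-cong (sym (qint-suc x a)) (sym (*-assoc _ _ _)) ⟩
    qint x (suc a) + x ^ suc a * qint x b     ∎

  qint-double : ∀ x r → qint x (2 ℕ.* r) ≈ qint x 2 * qint (x * x) r
  qint-double x zero = sym (zeroʳ _)
  qint-double x (suc r) = begin
    qint x (2 ℕ.* suc r)                            ≡⟨ ≡.cong (qint x) (ℕ.*-distribˡ-+ 2 1 r) ⟩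
    qint x (2 ℕ.+ 2 ℕ.* r)                          ≈⟨ qint-+ x 2 (2 ℕ.* r) ⟩
    qint x 2 + x ^ 2 * qint x (2 ℕ.* r)             ≈⟨ +-congˡ (*-cong (sym (square^ x 1)) (qint-double x r)) ⟩
    qint x 2 + (x * x) ^ 1 * (qint x 2 * qint (x * x) r)
      ≈⟨ solve 3 (λ t y g → t :+ y :* (t :* g) := t :* (con 1 :+ y :* g)) refl (qint x 2) ((x * x) ^ 1) (qint (x * x) r) ⟩
    qint x 2 * (1# + (x * x) ^ 1 * qint (x * x) r)  ≈⟨ *-congˡ (+-congˡ (*-congʳ (*-identityʳ _))) ⟩
    qint x 2 * (1# + (x * x) * qint (x * x) r)      ≈⟨ *-congˡ (sym (qint-suc (x * x) r)) ⟩
    qint x 2 * qint (x * x) (suc r)                 ∎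

  qbinom-vanish : ∀ x m j → m < j → qbinom x m j ≈ 0#
  qbinom-vanish x zero (suc j) _ = refl
  qbinom-vanish x (suc m) (suc j) (s≤s m<j) =
    trans (+-cong (qbinom-vanish x m j m<j) (*-congˡ (qbinom-vanish x m (suc j) (ℕ.m≤n⇒m≤1+n m<j))))
          (trans (+-congˡ (zeroʳ _)) (+-identityˡ 0#))

  qbinom-absorb : ∀ x m k → qint x (suc k) * qbinom x m (suc k) ≈ qint x (m ∸ k) * qbinom x m k
  qbinom-absorb x zero k = begin
    qint x (suc k) * 0#       ≈⟨ zeroʳ _ ⟩
    0#                        ≈⟨ sym (zeroˡ _) ⟩
    0# * qbinom x 0 k         ≡⟨ ≡.cong (λ a → qint x a * qbinom x 0 k) (≡.sym (ℕ.0∸n≡0 k)) ⟩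
    qint x (0 ∸ k) * qbinom x 0 k ∎
  qbinom-absorb x (suc m) zero = begin
    qint x 1 * (1# + x ^ 1 * qbinom x m 1)
      ≈⟨ solve 4 (λ a o b c → a :* (o :+ b :* c) := a :* o :+ b :* (a :* c)) refl (qint x 1) 1# (x ^ 1) (qbinom x m 1) ⟩
    qint x 1 * 1# + x ^ 1 * (qint x 1 * qbinom x m 1)
      ≈⟨ +-cong (trans (*-identityʳ _) (qint-1 x)) (*-cong (*-identityʳ x) (trans (qbinom-absorb x m zero) (*-identityʳ _))) ⟩
    1# + x * qint x m         ≈⟨ sym (qint-suc x m) ⟩
    qint x (suc m)            ≈⟨ sym (*-identityʳ _) ⟩
    qint x (suc m) * 1#       ∎
  qbinom-absorb x (suc m) (suc k) = begin
    qint x (2 ℕ.+ k) * (G₁ + x ^ (2 ℕ.+ k) * qbinom x m (2 ℕ.+ k))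
      ≈⟨ solve 4 (λ a g b h → a :* (g :+ b :* h) := a :* g :+ b :* (a :* h)) refl (qint x (2 ℕ.+ k)) G₁ (x ^ (2 ℕ.+ k)) _ ⟩
    qint x (2 ℕ.+ k) * G₁ + x ^ (2 ℕ.+ k) * (qint x (2 ℕ.+ k) * qbinom x m (2 ℕ.+ k))
      ≈⟨ +-congˡ (*-congˡ (qbinom-absorb x m (suc k))) ⟩
    qint x (2 ℕ.+ k) * G₁ + x ^ (2 ℕ.+ k) * (qint x (m ∸ suc k) * G₁)
      ≈⟨ solve 4 (λ a b c g → a :* g :+ b :* (c :* g) := (a :+ b :* c) :* g) refl (qint x (2 ℕ.+ k)) (x ^ (2 ℕ.+ k)) (qint x (m ∸ suc k)) G₁ ⟩
    (qint x (2 ℕ.+ k) + x ^ (2 ℕ.+ k) * qint x (m ∸ suc k)) * G₁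
      ≈⟨ same-coefficient ⟩
    (qint x (suc k) + x ^ suc k * qint x (m ∸ k)) * G₁
      ≈⟨ solve 4 (λ a b c g → (a :+ b :* c) :* g := a :* g :+ b :* (c :* g)) refl (qint x (suc k)) (x ^ suc k) (qint x (m ∸ k)) G₁ ⟩
    qint x (suc k) * G₁ + x ^ suc k * (qint x (m ∸ k) * G₁)
      ≈⟨ +-congʳ (qbinom-absorb x m k) ⟩
    qint x (m ∸ k) * qbinom x m k + x ^ suc k * (qint x (m ∸ k) * G₁)
      ≈⟨ solve 4 (λ a g b h → a :* g :+ b :* (a :* h) := a :* (g :+ b :* h)) refl (qint x (m ∸ k)) (qbinom x m k) (x ^ suc k) G₁ ⟩
    qint x (m ∸ k) * (qbinom x m k + x ^ suc k * G₁) ∎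
    where
      G₁ = qbinom x m (suc k)
      -- both coefficients are [m+1]_x, unless k ≥ m, where G₁ vanishes
      same-coefficient : (qint x (2 ℕ.+ k) + x ^ (2 ℕ.+ k) * qint x (m ∸ suc k)) * G₁
                       ≈ (qint x (suc k) + x ^ suc k * qint x (m ∸ k)) * G₁
      same-coefficient with suc k ℕ.≤? m
      ... | yes k<m = *-congʳ (begin
        qint x (2 ℕ.+ k) + x ^ (2 ℕ.+ k) * qint x (m ∸ suc k) ≈⟨ sym (qint-+ x (2 ℕ.+ k) (m ∸ suc k)) ⟩
        qint x (suc (suc k ℕ.+ (m ∸ suc k)))                   ≡⟨ ≡.cong (qint x ∘ suc)
                                                                    (≡.trans (ℕ.m+[n∸m]≡n k<m) (≡.sym (ℕ.m+[n∸m]≡n (ℕ.<⇒≤ k<m)))) ⟩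
        qint x (suc k ℕ.+ (m ∸ k))                             ≈⟨ qint-+ x (suc k) (m ∸ k) ⟩
        qint x (suc k) + x ^ suc k * qint x (m ∸ k)            ∎)
      ... | no k≮m = trans (*-congˡ G₁≈0) (trans (zeroʳ _) (sym (trans (*-congˡ G₁≈0) (zeroʳ _))))
        where G₁≈0 = qbinom-vanish x m (suc k) (ℕ.≰⇒> k≮m)

  qbinom² : ℕ → ℕ → Carrier
  qbinom² = qbinom (q * q)

  qint-+-comm : ∀ x a b → qint x a + x ^ a * qint x b ≈ qint x b + x ^ b * qint x a
  qint-+-comm x a b = begin
    qint x a + x ^ a * qint x b   ≈⟨ sym (qint-+ x a b) ⟩
    qint x (a ℕ.+ b)              ≡⟨ ≡.cong (qint x) (ℕ.+-comm a b) ⟩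
    qint x (b ℕ.+ a)              ≈⟨ qint-+ x b a ⟩
    qint x b + x ^ b * qint x a   ∎

  odd-split : ∀ m j → qint q (suc (2 ℕ.* m)) * qbinom² m j
                    ≈ (qint q (suc (2 ℕ.* j)) + q ^ suc (2 ℕ.* j) * qint q (2 ℕ.* (m ∸ j))) * qbinom² m j
  odd-split m j with j ℕ.≤? m
  ... | yes j≤m = *-congʳ (trans (reflexive (≡.cong (qint q) length≡)) (qint-+ q (suc (2 ℕ.* j)) (2 ℕ.* (m ∸ j))))
    where
      length≡ : suc (2 ℕ.* m) ≡.≡ suc (2 ℕ.* j) ℕ.+ 2 ℕ.* (m ∸ j)
      length≡ = ≡.cong suc (≡.trans (≡.cong (2 ℕ.*_) (≡.sym (ℕ.m+[n∸m]≡n j≤m))) (ℕ.*-distribˡ-+ 2 j (m ∸ j)))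
  ... | no j≰m = trans (*-congˡ G≈0) (trans (zeroʳ _) (sym (trans (*-congˡ G≈0) (zeroʳ _))))
    where G≈0 = qbinom-vanish (q * q) m j (ℕ.≰⇒> j≰m)

  even-absorb : ∀ m j → qint q (2 ℕ.* (m ∸ j)) * qbinom² m j ≈ qint q (2 ℕ.* suc j) * qbinom² m (suc j)
  even-absorb m j = begin
    qint q (2 ℕ.* (m ∸ j)) * qbinom² m j                ≈⟨ *-congʳ (qint-double q (m ∸ j)) ⟩
    (qint q 2 * qint (q * q) (m ∸ j)) * qbinom² m j     ≈⟨ *-assoc _ _ _ ⟩
    qint q 2 * (qint (q * q) (m ∸ j) * qbinom² m j)     ≈⟨ *-congˡ (sym (qbinom-absorb (q * q) m j)) ⟩
    qint q 2 * (qint (q * q) (suc j) * qbinom² m (suc j)) ≈⟨ sym (*-assoc _ _ _) ⟩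
    (qint q 2 * qint (q * q) (suc j)) * qbinom² m (suc j) ≈⟨ *-congʳ (sym (qint-double q (suc j))) ⟩
    qint q (2 ℕ.* suc j) * qbinom² m (suc j)            ∎

  binomial-step : ∀ l j m →
    q ^ suc (2 ℕ.* j) * qint q (suc (2 ℕ.* l)) * qbinom² (suc m) (suc j) + qint q (suc (2 ℕ.* m)) * qbinom² m j
    ≈ qint q (2 ℕ.* suc (l ℕ.+ j)) * qbinom² m j + qint q (suc (2 ℕ.* suc (l ℕ.+ j))) * (q ^ suc (2 ℕ.* j) * qbinom² m (suc j))
  binomial-step l j m = begin
    p * A * (G₀ + X * G₁) + qint q (suc (2 ℕ.* m)) * G₀       ≈⟨ +-congˡ (odd-split m j) ⟩
    p * A * (G₀ + X * G₁) + (B + p * D) * G₀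
      ≈⟨ solve 7 (λ p a g₀ x g₁ b d → p :* a :* (g₀ :+ x :* g₁) :+ (b :+ p :* d) :* g₀
                                    := (b :+ p :* a) :* g₀ :+ p :* (x :* a :* g₁ :+ d :* g₀)) refl p A G₀ X G₁ B D ⟩
    (B + p * A) * G₀ + p * (X * A * G₁ + D * G₀)              ≈⟨ +-congˡ (*-congˡ (+-congˡ (even-absorb m j))) ⟩
    (B + p * A) * G₀ + p * (X * A * G₁ + C * G₁)
      ≈⟨ +-congˡ (solve 5 (λ p a x g₁ c → p :* (x :* a :* g₁ :+ c :* g₁) := (c :+ x :* a) :* (p :* g₁)) refl p A X G₁ C) ⟩
    (B + p * A) * G₀ + (C + X * A) * (p * G₁)                 ≈⟨ +-congˡ (*-congʳ (+-congˡ (*-congʳ (square^ q (suc j))))) ⟩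
    (B + p * A) * G₀ + (C + q ^ (2 ℕ.* suc j) * A) * (p * G₁) ≈⟨ +-congˡ (*-congʳ (qint-+-comm q (2 ℕ.* suc j) (suc (2 ℕ.* l)))) ⟩
    (B + p * A) * G₀ + (A + s * C) * (p * G₁)
      ≈⟨ +-cong (*-congʳ (sym (split (suc (2 ℕ.* j)) (suc (2 ℕ.* l)) (e₁ l j))))
                (*-congʳ (sym (split (suc (2 ℕ.* l)) (2 ℕ.* suc j) (e₂ l j)))) ⟩
    qint q (2 ℕ.* suc (l ℕ.+ j)) * G₀ + qint q (suc (2 ℕ.* suc (l ℕ.+ j))) * (p * G₁) ∎
    where
      p = q ^ suc (2 ℕ.* j)
      s = q ^ suc (2 ℕ.* l)
      A = qint q (suc (2 ℕ.* l))
      B = qint q (suc (2 ℕ.* j))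
      C = qint q (2 ℕ.* suc j)
      D = qint q (2 ℕ.* (m ∸ j))
      X = (q * q) ^ suc j
      G₀ = qbinom² m j
      G₁ = qbinom² m (suc j)
      split : ∀ a b {c} → c ≡.≡ a ℕ.+ b → qint q c ≈ qint q a + q ^ a * qint q b
      split a b ≡.refl = qint-+ q a b
      e₁ : ∀ l j → 2 ℕ.* suc (l ℕ.+ j) ≡.≡ suc (2 ℕ.* j) ℕ.+ suc (2 ℕ.* l)
      e₁ = ℕ-Solver.solve-∀
      e₂ : ∀ l j → suc (2 ℕ.* suc (l ℕ.+ j)) ≡.≡ suc (2 ℕ.* l) ℕ.+ 2 ℕ.* suc j
      e₂ = ℕ-Solver.solve-∀

  -- The recurrence of B_{n,k}

  -- (des_B π , fmaj π), read off the word 0 π₁ ⋯ πₙ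
  typeBStat : List ℤ → ℕ × ℕ
  typeBStat π = stat 0 (ℤ.+ 0 ∷ π)

  weight : ℕ → ℕ × ℕ → Carrier
  weight K (d , W) = if d ≡ᵇ K then q ^ W else 0#

  Bnk-weight : ∀ n K → Bnk n K ≈ sumR (map (weight K ∘ typeBStat) (signedPerms n))
  Bnk-weight n K = sumR-filterᵇ (λ π → q ^ fmaj π) (λ π → desB π ≡ᵇ K) (signedPerms n)

  weight-block : ∀ K d w m → sumR (map (weight K) (block d w m)) ≈ (if d ≡ᵇ K then q ^ w * qint q m else 0#)
  weight-block K d w m = by-cases (d ≡ᵇ K) ≡.refl w m
    where
      by-cases : ∀ b → (d ≡ᵇ K) ≡.≡ b → ∀ w m → sumR (map (weight K) (block d w m)) ≈ (if b then q ^ w * qint q m else 0#)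
      by-cases b d≡K w zero = sym (if-zero b)
        where
          if-zero : ∀ b → (if b then q ^ w * 0# else 0#) ≈ 0#
          if-zero true = zeroʳ _
          if-zero false = refl
      by-cases true d≡K w (suc m) = begin
        weight K (d , w) + sumR (map (weight K) (block d (suc w) m))
          ≈⟨ +-cong (reflexive (≡.cong (λ b → if b then q ^ w else 0#) d≡K)) (by-cases true d≡K (suc w) m) ⟩
        q ^ w + (q * q ^ w) * qint q m
          ≈⟨ solve 3 (λ a q k → a :+ (q :* a) :* k := a :* (con 1 :+ q :* k)) refl (q ^ w) q (qint q m) ⟩
        q ^ w * (1# + q * qint q m)   ≈⟨ *-congˡ (sym (qint-suc q m)) ⟩
        q ^ w * qint q (suc m)        ∎
      by-cases false d≢K w (suc m) = begin
        weight K (d , w) + sumR (map (weight K) (block d (suc w) m))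
          ≈⟨ +-cong (reflexive (≡.cong (λ b → if b then q ^ w else 0#) d≢K)) (by-cases false d≢K (suc w) m) ⟩
        0# + 0#   ≈⟨ +-identityˡ 0# ⟩
        0#        ∎

  if-≡ᵇ-scale : ∀ d K x y z → (d ≡.≡ K → x ≈ z * y) → (if d ≡ᵇ K then x else 0#) ≈ z * (if d ≡ᵇ K then y else 0#)
  if-≡ᵇ-scale d K x y z x≈zy with d ≡ᵇ K in d≡K
  ... | true = x≈zy (ℕ.≡ᵇ⇒≡ d K (≡.subst T (≡.sym d≡K) tt))
  ... | false = sym (zeroʳ z)

  sumR-weight-scale : ∀ n K z (f : List ℤ → Carrier) →
    (∀ {π} → π ∈ signedPerms n → f π ≈ z * weight K (typeBStat π)) → sumR (map f (signedPerms n)) ≈ z * Bnk n K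
  sumR-weight-scale n K z f f≈ = begin
    sumR (map f (signedPerms n))                                     ≈⟨ sumR-cong (signedPerms n) f≈ ⟩
    sumR (map (λ π → z * weight K (typeBStat π)) (signedPerms n))    ≈⟨ sym (*-sumR z _ (signedPerms n)) ⟩
    z * sumR (map (weight K ∘ typeBStat) (signedPerms n))            ≈⟨ *-congˡ (sym (Bnk-weight n K)) ⟩
    z * Bnk n K                                                      ∎

  -- the insertions that keep the number of descents, and those that raise it by one
  keepTerm riseTerm : ℕ → List ℤ → Carrier
  keepTerm K π = let (d , W) = typeBStat π in
    if d ≡ᵇ K then q ^ W * qint q (suc (2 ℕ.* d)) else 0#
  riseTerm K π = let (d , W) = typeBStat π in
    if suc d ≡ᵇ K then q ^ (W ℕ.+ suc (2 ℕ.* d)) * qint q (suc (2 ℕ.* ascents (ℤ.+ 0 ∷ π))) else 0#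

  Bnk-suc : ∀ n K → Bnk (suc n) K ≈ sumR (map (keepTerm K) (signedPerms n)) + sumR (map (riseTerm K) (signedPerms n))
  Bnk-suc n K = begin
    Bnk (suc n) K                                                    ≈⟨ Bnk-weight (suc n) K ⟩
    sumR (map w (signedPerms (suc n)))                               ≈⟨ sumR-↭ (↭-map⁺ w (signedPerms-suc n)) ⟩
    sumR (map w (insertions n))                                      ≈⟨ sumR-concatMap w (insert± n) (signedPerms n) ⟩
    sumR (map (λ π → sumR (map w (insert± n π))) (signedPerms n))    ≈⟨ sumR-cong (signedPerms n) (per-perm ∘ signedPerm-small) ⟩
    sumR (map (λ π → keepTerm K π + riseTerm K π) (signedPerms n))   ≈⟨ sumR-+ (keepTerm K) (riseTerm K) (signedPerms n) ⟩
    sumR (map (keepTerm K) (signedPerms n)) + sumR (map (riseTerm K) (signedPerms n)) ∎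
    where
      w = weight K ∘ typeBStat
      per-perm : ∀ {π} → All (Small n) π → sumR (map w (insert± n π)) ≈ keepTerm K π + riseTerm K π
      per-perm {π} π≤n = begin
        sumR (map w (insert± n π))                              ≡⟨ ≡.cong sumR (map-∘ (insert± n π)) ⟩
        sumR (map (weight K) (map (λ v → stat 0 (ℤ.+ 0 ∷ v)) (insert± n π)))
          ≈⟨ sumR-↭ (↭-map⁺ (weight K) (stat-insert± n 0 (ℤ.+ 0) π z≤n π≤n)) ⟩
        sumR (map (weight K) (B₁ ++ B₂))                        ≡⟨ ≡.cong sumR (map-++ (weight K) B₁ B₂) ⟩
        sumR (map (weight K) B₁ ++ map (weight K) B₂)           ≈⟨ sumR-++ (map (weight K) B₁) (map (weight K) B₂) ⟩
        sumR (map (weight K) B₁) + sumR (map (weight K) B₂)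
          ≈⟨ +-cong (weight-block K d W (suc (2 ℕ.* d))) (weight-block K (suc d) (W ℕ.+ suc (2 ℕ.* d)) (suc (2 ℕ.* ascents (ℤ.+ 0 ∷ π)))) ⟩
        keepTerm K π + riseTerm K π                             ∎
        where
          d = proj₁ (typeBStat π)
          W = proj₂ (typeBStat π)
          B₁ = block d W (suc (2 ℕ.* d))
          B₂ = block (suc d) (W ℕ.+ suc (2 ℕ.* d)) (suc (2 ℕ.* ascents (ℤ.+ 0 ∷ π)))

  keepTerm-sum : ∀ n K → sumR (map (keepTerm K) (signedPerms n)) ≈ qint q (suc (2 ℕ.* K)) * Bnk n K
  keepTerm-sum n K = sumR-weight-scale n K _ (keepTerm K) λ {π} _ →
    if-≡ᵇ-scale (proj₁ (typeBStat π)) K _ _ _ λ { ≡.refl → *-comm _ _ }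

  riseTerm-sum-zero : ∀ n → sumR (map (riseTerm 0) (signedPerms n)) ≈ 0#
  riseTerm-sum-zero n = trans (sumR-weight-scale n 0 0# (riseTerm 0) (λ _ → sym (zeroˡ _))) (zeroˡ _)

  riseTerm-sum-suc : ∀ n K → sumR (map (riseTerm (suc K)) (signedPerms n))
                   ≈ (q ^ suc (2 ℕ.* K) * qint q (suc (2 ℕ.* (n ∸ K)))) * Bnk n K
  riseTerm-sum-suc n K = sumR-weight-scale n K _ (riseTerm (suc K)) λ {π} π∈ →
    if-≡ᵇ-scale (proj₁ (typeBStat π)) K _ _ _ λ { ≡.refl → rise π π∈ }
    where
      rise : ∀ π → π ∈ signedPerms n → let (d , W) = typeBStat π in
        q ^ (W ℕ.+ suc (2 ℕ.* d)) * qint q (suc (2 ℕ.* ascents (ℤ.+ 0 ∷ π)))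
        ≈ (q ^ suc (2 ℕ.* d) * qint q (suc (2 ℕ.* (n ∸ d)))) * q ^ W
      rise π π∈ = begin
        q ^ (W ℕ.+ suc (2 ℕ.* d)) * qint q (suc (2 ℕ.* a))    ≈⟨ *-congʳ (^-+ q W (suc (2 ℕ.* d))) ⟩
        (q ^ W * q ^ suc (2 ℕ.* d)) * qint q (suc (2 ℕ.* a))  ≡⟨ ≡.cong (λ a → (q ^ W * q ^ suc (2 ℕ.* d)) * qint q (suc (2 ℕ.* a))) a≡n∸d ⟩
        (q ^ W * q ^ suc (2 ℕ.* d)) * qint q (suc (2 ℕ.* (n ∸ d)))
          ≈⟨ solve 3 (λ w a b → (w :* a) :* b := (a :* b) :* w) refl (q ^ W) (q ^ suc (2 ℕ.* d)) (qint q (suc (2 ℕ.* (n ∸ d)))) ⟩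
        (q ^ suc (2 ℕ.* d) * qint q (suc (2 ℕ.* (n ∸ d)))) * q ^ W ∎
        where
          d = proj₁ (typeBStat π)
          W = proj₂ (typeBStat π)
          a = ascents (ℤ.+ 0 ∷ π)
          a≡n∸d : a ≡.≡ n ∸ d
          a≡n∸d = ≡.trans (≡.sym (ℕ.m+n∸m≡n d a))
                    (≡.cong (_∸ d) (≡.trans (desFrom+ascents 0 (ℤ.+ 0) π) (proj₁ (∈-signedPerms⁻ n π∈))))

  Bnk-suc-zero : ∀ n → Bnk (suc n) 0 ≈ qint q 1 * Bnk n 0
  Bnk-suc-zero n = trans (Bnk-suc n 0) (trans (+-cong (keepTerm-sum n 0) (riseTerm-sum-zero n)) (+-identityʳ _))

  Bnk-suc-suc : ∀ n K → Bnk (suc n) (suc K)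
              ≈ qint q (suc (2 ℕ.* suc K)) * Bnk n (suc K) + (q ^ suc (2 ℕ.* K) * qint q (suc (2 ℕ.* (n ∸ K)))) * Bnk n K
  Bnk-suc-suc n K = trans (Bnk-suc n (suc K)) (+-cong (keepTerm-sum n (suc K)) (riseTerm-sum-suc n K))

  Bnk-vanish : ∀ n K → n < K → Bnk n K ≈ 0#
  Bnk-vanish zero (suc K) _ = refl
  Bnk-vanish (suc n) (suc K) (s≤s n<K) = begin
    Bnk (suc n) (suc K)                          ≈⟨ Bnk-suc-suc n K ⟩
    _ * Bnk n (suc K) + _ * Bnk n K              ≈⟨ +-cong (*-congˡ (Bnk-vanish n (suc K) (ℕ.m≤n⇒m≤1+n n<K))) (*-congˡ (Bnk-vanish n K n<K)) ⟩
    _ * 0# + _ * 0#                              ≈⟨ trans (+-cong (zeroʳ _) (zeroʳ _)) (+-identityʳ 0#) ⟩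
    0#                                           ∎

  module _ (qq⁻¹≈1 : q * q⁻¹ ≈ 1#) where

    qᶻ-⊖ : ∀ a b → qᶻ (a ⊖ b) ≈ q ^ a * q⁻¹ ^ b
    qᶻ-⊖ zero zero = sym (*-identityˡ 1#)
    qᶻ-⊖ (suc a) zero = sym (*-identityʳ _)
    qᶻ-⊖ zero (suc b) = sym (*-identityˡ _)
    qᶻ-⊖ (suc a) (suc b) = begin
      qᶻ (suc a ⊖ suc b)            ≡⟨ ≡.cong qᶻ (ℤ.[1+m]⊖[1+n]≡m⊖n a b) ⟩
      qᶻ (a ⊖ b)                    ≈⟨ qᶻ-⊖ a b ⟩
      q ^ a * q⁻¹ ^ b               ≈⟨ sym (*-identityˡ _) ⟩
      1# * (q ^ a * q⁻¹ ^ b)        ≈⟨ *-congʳ (sym qq⁻¹≈1) ⟩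
      (q * q⁻¹) * (q ^ a * q⁻¹ ^ b)
        ≈⟨ solve 4 (λ q u a b → (q :* u) :* (a :* b) := (q :* a) :* (u :* b)) refl q q⁻¹ (q ^ a) (q⁻¹ ^ b) ⟩
      q ^ suc a * q⁻¹ ^ suc b       ∎

    ^-cancel : ∀ a b t → q ^ (a ℕ.+ t) * q⁻¹ ^ (b ℕ.+ t) ≈ q ^ a * q⁻¹ ^ b
    ^-cancel a b t = begin
      q ^ (a ℕ.+ t) * q⁻¹ ^ (b ℕ.+ t)           ≈⟨ *-cong (^-+ q a t) (^-+ q⁻¹ b t) ⟩
      (q ^ a * q ^ t) * (q⁻¹ ^ b * q⁻¹ ^ t)
        ≈⟨ solve 4 (λ a b c d → (a :* b) :* (c :* d) := (a :* c) :* (b :* d)) refl (q ^ a) (q ^ t) (q⁻¹ ^ b) (q⁻¹ ^ t) ⟩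
      (q ^ a * q⁻¹ ^ b) * (q ^ t * q⁻¹ ^ t)     ≈⟨ *-congˡ (trans (sym (^-distrib-* q q⁻¹ t)) (trans (^-cong t qq⁻¹≈1) (1^ t))) ⟩
      (q ^ a * q⁻¹ ^ b) * 1#                    ≈⟨ *-identityʳ _ ⟩
      q ^ a * q⁻¹ ^ b                           ∎

    laurent : ℕ → ℕ → Carrier
    laurent k l = qᶻ (ℤ.+ k ℤ.* (ℤ.+ k ℤ.- ℤ.+ (2 ℕ.* l)))

    laurent≈ : ∀ k l → laurent k l ≈ q ^ (k ℕ.* k) * q⁻¹ ^ (k ℕ.* (2 ℕ.* l))
    laurent≈ k l = begin
      laurent k l                                           ≡⟨ ≡.cong qᶻ exponent ⟩
      qᶻ (k ℕ.* k ⊖ k ℕ.* (2 ℕ.* l))                        ≈⟨ qᶻ-⊖ (k ℕ.* k) (k ℕ.* (2 ℕ.* l)) ⟩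
      q ^ (k ℕ.* k) * q⁻¹ ^ (k ℕ.* (2 ℕ.* l))               ∎
      where
        m = 2 ℕ.* l
        ℤ-distrib : ∀ a b → a ℤ.* (a ℤ.- b) ≡.≡ a ℤ.* a ℤ.- a ℤ.* b
        ℤ-distrib = ℤ-Solver.solve-∀
        exponent : ℤ.+ k ℤ.* (ℤ.+ k ℤ.- ℤ.+ m) ≡.≡ k ℕ.* k ⊖ k ℕ.* m
        exponent = ≡.trans (ℤ-distrib (ℤ.+ k) (ℤ.+ m))
          (≡.trans (≡.cong₂ ℤ._-_ (≡.sym (ℤ.pos-* k k)) (≡.sym (ℤ.pos-* k m))) (ℤ.m-n≡m⊖n (k ℕ.* k) (k ℕ.* m)))

    laurent-raise : ∀ l j → laurent (suc (l ℕ.+ j)) l ≈ laurent (l ℕ.+ j) l * q ^ suc (2 ℕ.* j)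
    laurent-raise l j = begin
      laurent K l                                                         ≈⟨ laurent≈ K l ⟩
      q ^ (K ℕ.* K) * q⁻¹ ^ (K ℕ.* (2 ℕ.* l))                             ≡⟨ ≡.cong₂ (λ a b → q ^ a * q⁻¹ ^ b) (e₁ l j) (e₂ l j) ⟩
      q ^ ((k ℕ.* k ℕ.+ suc (2 ℕ.* j)) ℕ.+ 2 ℕ.* l) * q⁻¹ ^ (k ℕ.* (2 ℕ.* l) ℕ.+ 2 ℕ.* l)
        ≈⟨ ^-cancel (k ℕ.* k ℕ.+ suc (2 ℕ.* j)) (k ℕ.* (2 ℕ.* l)) (2 ℕ.* l) ⟩
      q ^ (k ℕ.* k ℕ.+ suc (2 ℕ.* j)) * q⁻¹ ^ (k ℕ.* (2 ℕ.* l))          ≈⟨ *-congʳ (^-+ q (k ℕ.* k) (suc (2 ℕ.* j))) ⟩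
      (q ^ (k ℕ.* k) * q ^ suc (2 ℕ.* j)) * q⁻¹ ^ (k ℕ.* (2 ℕ.* l))
        ≈⟨ solve 3 (λ a b c → (a :* b) :* c := (a :* c) :* b) refl (q ^ (k ℕ.* k)) (q ^ suc (2 ℕ.* j)) (q⁻¹ ^ (k ℕ.* (2 ℕ.* l))) ⟩
      (q ^ (k ℕ.* k) * q⁻¹ ^ (k ℕ.* (2 ℕ.* l))) * q ^ suc (2 ℕ.* j)      ≈⟨ *-congʳ (sym (laurent≈ k l)) ⟩
      laurent k l * q ^ suc (2 ℕ.* j)                                     ∎
      where
        k = l ℕ.+ j
        K = suc k
        e₁ : ∀ l j → suc (l ℕ.+ j) ℕ.* suc (l ℕ.+ j) ≡.≡ ((l ℕ.+ j) ℕ.* (l ℕ.+ j) ℕ.+ suc (2 ℕ.* j)) ℕ.+ 2 ℕ.* l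
        e₁ = ℕ-Solver.solve-∀
        e₂ : ∀ l j → suc (l ℕ.+ j) ℕ.* (2 ℕ.* l) ≡.≡ (l ℕ.+ j) ℕ.* (2 ℕ.* l) ℕ.+ 2 ℕ.* l
        e₂ = ℕ-Solver.solve-∀

    laurent-lower : ∀ l j → laurent (suc (l ℕ.+ j)) (suc l) * q ^ suc (2 ℕ.* l) ≈ laurent (l ℕ.+ j) l
    laurent-lower l j = begin
      laurent K (suc l) * q ^ suc (2 ℕ.* l)                               ≈⟨ *-congʳ (laurent≈ K (suc l)) ⟩
      (q ^ (K ℕ.* K) * q⁻¹ ^ (K ℕ.* (2 ℕ.* suc l))) * q ^ suc (2 ℕ.* l)
        ≈⟨ solve 3 (λ a b c → (a :* b) :* c := (a :* c) :* b) refl (q ^ (K ℕ.* K)) (q⁻¹ ^ (K ℕ.* (2 ℕ.* suc l))) (q ^ suc (2 ℕ.* l)) ⟩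
      (q ^ (K ℕ.* K) * q ^ suc (2 ℕ.* l)) * q⁻¹ ^ (K ℕ.* (2 ℕ.* suc l))  ≈⟨ *-congʳ (sym (^-+ q (K ℕ.* K) (suc (2 ℕ.* l)))) ⟩
      q ^ (K ℕ.* K ℕ.+ suc (2 ℕ.* l)) * q⁻¹ ^ (K ℕ.* (2 ℕ.* suc l))      ≡⟨ ≡.cong₂ (λ a b → q ^ a * q⁻¹ ^ b) (e₁ l j) (e₂ l j) ⟩
      q ^ (k ℕ.* k ℕ.+ t) * q⁻¹ ^ (k ℕ.* (2 ℕ.* l) ℕ.+ t)                ≈⟨ ^-cancel (k ℕ.* k) (k ℕ.* (2 ℕ.* l)) t ⟩
      q ^ (k ℕ.* k) * q⁻¹ ^ (k ℕ.* (2 ℕ.* l))                             ≈⟨ sym (laurent≈ k l) ⟩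
      laurent k l                                                         ∎
      where
        k = l ℕ.+ j
        K = suc k
        t = 4 ℕ.* l ℕ.+ 2 ℕ.* j ℕ.+ 2
        e₁ : ∀ l j → suc (l ℕ.+ j) ℕ.* suc (l ℕ.+ j) ℕ.+ suc (2 ℕ.* l) ≡.≡ (l ℕ.+ j) ℕ.* (l ℕ.+ j) ℕ.+ (4 ℕ.* l ℕ.+ 2 ℕ.* j ℕ.+ 2)
        e₁ = ℕ-Solver.solve-∀
        e₂ : ∀ l j → suc (l ℕ.+ j) ℕ.* (2 ℕ.* suc l) ≡.≡ (l ℕ.+ j) ℕ.* (2 ℕ.* l) ℕ.+ (4 ℕ.* l ℕ.+ 2 ℕ.* j ℕ.+ 2)
        e₂ = ℕ-Solver.solve-∀

    -- The recurrence of the right-hand side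

    term : ℕ → ℕ → ℕ → Carrier
    term n k l = laurent k l * Bnk n l * qbinom² (n ∸ l) (k ∸ l)

    rhs : ℕ → ℕ → Carrier
    rhs n k = ∑[ l < suc k ] term n k l

    -- term (n+1) k l splits, by the recurrence of B, into a part from B n l and a part from B n (l-1)
    keepPart risePart : ℕ → ℕ → ℕ → Carrier
    keepPart n k l = laurent k l * qint q (suc (2 ℕ.* l)) * Bnk n l * qbinom² (suc n ∸ l) (k ∸ l)
    risePart n k l = laurent (suc k) (suc l) * (q ^ suc (2 ℕ.* l) * qint q (suc (2 ℕ.* (n ∸ l)))) * Bnk n l * qbinom² (n ∸ l) (k ∸ l)

    term-suc-zero : ∀ n k → term (suc n) k 0 ≈ keepPart n k 0
    term-suc-zero n k = *-congʳ (trans (*-congˡ (Bnk-suc-zero n)) (sym (*-assoc _ _ _)))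

    term-suc-suc : ∀ n k l → term (suc n) (suc k) (suc l) ≈ keepPart n (suc k) (suc l) + risePart n k l
    term-suc-suc n k l = begin
      laurent (suc k) (suc l) * Bnk (suc n) (suc l) * qbinom² (n ∸ l) (k ∸ l)     ≈⟨ *-congʳ (*-congˡ (Bnk-suc-suc n l)) ⟩
      z * (a * Bnk n (suc l) + b * Bnk n l) * g
        ≈⟨ solve 6 (λ z a b₁ b b₀ g → z :* (a :* b₁ :+ b :* b₀) :* g := z :* a :* b₁ :* g :+ z :* b :* b₀ :* g)
             refl z a (Bnk n (suc l)) b (Bnk n l) g ⟩
      keepPart n (suc k) (suc l) + risePart n k l                                 ∎
      where
        z = laurent (suc k) (suc l)
        a = qint q (suc (2 ℕ.* suc l))
        b = q ^ suc (2 ℕ.* l) * qint q (suc (2 ℕ.* (n ∸ l)))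
        g = qbinom² (n ∸ l) (k ∸ l)

    private
      suc+∸ : ∀ a b → suc (a ℕ.+ b) ∸ a ≡.≡ suc b
      suc+∸ a b = ≡.trans (≡.cong (_∸ a) (≡.sym (ℕ.+-suc a b))) (ℕ.m+n∸m≡n a (suc b))

      vanishing : ∀ {a B} g → B ≈ 0# → a * B * g ≈ 0#
      vanishing g B≈0 = trans (*-congʳ (trans (*-congˡ B≈0) (zeroʳ _))) (zeroˡ g)

    pair-identity : ∀ n k l → l ≤ k →
      keepPart n (suc k) l + risePart n k l ≈ qint q (2 ℕ.* suc k) * term n k l + qint q (suc (2 ℕ.* suc k)) * term n (suc k) l
    pair-identity n k l l≤k with l ℕ.≤? n
    ... | yes l≤n = ≡.subst₂ (λ n k → keepPart n (suc k) l + risePart n k l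
                                      ≈ qint q (2 ℕ.* suc k) * term n k l + qint q (suc (2 ℕ.* suc k)) * term n (suc k) l)
                      (ℕ.m+[n∸m]≡n l≤n) (ℕ.m+[n∸m]≡n l≤k) (shifted (n ∸ l) (k ∸ l))
      where
        shifted : ∀ m j → keepPart (l ℕ.+ m) (suc (l ℕ.+ j)) l + risePart (l ℕ.+ m) (l ℕ.+ j) l
          ≈ qint q (2 ℕ.* suc (l ℕ.+ j)) * term (l ℕ.+ m) (l ℕ.+ j) l + qint q (suc (2 ℕ.* suc (l ℕ.+ j))) * term (l ℕ.+ m) (suc (l ℕ.+ j)) l
        shifted m j = begin
          keepPart (l ℕ.+ m) K l + risePart (l ℕ.+ m) k′ l
            ≡⟨ ≡.cong₂ _+_ (≡.cong₂ (λ a b → laurent K l * A * Bn * qbinom² a b) (suc+∸ l m) (suc+∸ l j))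
                            (≡.cong₂ (λ a b → laurent K (suc l) * (s * qint q (suc (2 ℕ.* a))) * Bn * qbinom² a b)
                                     (ℕ.m+n∸m≡n l m) (ℕ.m+n∸m≡n l j)) ⟩
          laurent K l * A * Bn * qbinom² (suc m) (suc j) + laurent K (suc l) * (s * W) * Bn * G₀
            ≈⟨ +-cong (*-congʳ (*-congʳ (*-congʳ (laurent-raise l j))))
                      (*-congʳ (*-congʳ (trans (sym (*-assoc _ _ _)) (*-congʳ (laurent-lower l j))))) ⟩
          Y * p * A * Bn * qbinom² (suc m) (suc j) + Y * W * Bn * G₀
            ≈⟨ solve 7 (λ y p a b g w g₀ → y :* p :* a :* b :* g :+ y :* w :* b :* g₀ := (y :* b) :* (p :* a :* g :+ w :* g₀))
                 refl Y p A Bn (qbinom² (suc m) (suc j)) W G₀ ⟩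
          (Y * Bn) * (p * A * qbinom² (suc m) (suc j) + W * G₀)    ≈⟨ *-congˡ (binomial-step l j m) ⟩
          (Y * Bn) * (qint q (2 ℕ.* K) * G₀ + qint q (suc (2 ℕ.* K)) * (p * G₁))
            ≈⟨ solve 7 (λ y b c₀ g₀ c₁ p g₁ → (y :* b) :* (c₀ :* g₀ :+ c₁ :* (p :* g₁)) := c₀ :* (y :* b :* g₀) :+ c₁ :* (y :* p :* b :* g₁))
                 refl Y Bn (qint q (2 ℕ.* K)) G₀ (qint q (suc (2 ℕ.* K))) p G₁ ⟩
          qint q (2 ℕ.* K) * (Y * Bn * G₀) + qint q (suc (2 ℕ.* K)) * (Y * p * Bn * G₁)
            ≈⟨ +-congˡ (*-congˡ (*-congʳ (*-congʳ (sym (laurent-raise l j))))) ⟩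
          qint q (2 ℕ.* K) * (Y * Bn * G₀) + qint q (suc (2 ℕ.* K)) * (laurent K l * Bn * G₁)
            ≡⟨ ≡.sym (≡.cong₂ _+_ (≡.cong₂ (λ a b → qint q (2 ℕ.* K) * (Y * Bn * qbinom² a b)) (ℕ.m+n∸m≡n l m) (ℕ.m+n∸m≡n l j))
                                   (≡.cong₂ (λ a b → qint q (suc (2 ℕ.* K)) * (laurent K l * Bn * qbinom² a b)) (ℕ.m+n∸m≡n l m) (suc+∸ l j))) ⟩
          qint q (2 ℕ.* K) * term (l ℕ.+ m) k′ l + qint q (suc (2 ℕ.* K)) * term (l ℕ.+ m) K l ∎
          where
            k′ = l ℕ.+ j
            K = suc k′
            A = qint q (suc (2 ℕ.* l))
            Bn = Bnk (l ℕ.+ m) l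
            s = q ^ suc (2 ℕ.* l)
            W = qint q (suc (2 ℕ.* m))
            p = q ^ suc (2 ℕ.* j)
            Y = laurent k′ l
            G₀ = qbinom² m j
            G₁ = qbinom² m (suc j)
    ... | no l≰n = begin
      keepPart n (suc k) l + risePart n k l                 ≈⟨ +-cong (vanishing _ B≈0) (vanishing _ B≈0) ⟩
      0# + 0#
        ≈⟨ sym (+-cong (trans (*-congˡ (vanishing _ B≈0)) (zeroʳ _)) (trans (*-congˡ (vanishing _ B≈0)) (zeroʳ _))) ⟩
      qint q (2 ℕ.* suc k) * term n k l + qint q (suc (2 ℕ.* suc k)) * term n (suc k) l ∎
      where
        B≈0 = Bnk-vanish n l (ℕ.≰⇒> l≰n)

    top-identity : ∀ n k → keepPart n k k ≈ qint q (suc (2 ℕ.* k)) * term n k k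
    top-identity n k = begin
      laurent k k * A * Bnk n k * qbinom² (suc n ∸ k) (k ∸ k)   ≡⟨ ≡.cong (λ i → laurent k k * A * Bnk n k * qbinom² (suc n ∸ k) i) (ℕ.n∸n≡0 k) ⟩
      laurent k k * A * Bnk n k * 1#
        ≈⟨ solve 3 (λ z a b → z :* a :* b :* con 1 := a :* (z :* b :* con 1)) refl (laurent k k) A (Bnk n k) ⟩
      A * (laurent k k * Bnk n k * 1#)
        ≡⟨ ≡.cong (λ i → A * (laurent k k * Bnk n k * qbinom² (n ∸ k) i)) (≡.sym (ℕ.n∸n≡0 k)) ⟩
      A * term n k k                                            ∎
      where A = qint q (suc (2 ℕ.* k))

    rhs-suc-zero : ∀ n → rhs (suc n) 0 ≈ rhs n 0
    rhs-suc-zero n = +-congʳ (*-congʳ (*-congˡ (trans (Bnk-suc-zero n) (trans (*-congʳ (qint-1 q)) (*-identityˡ _)))))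

    rhs-suc : ∀ n k → rhs (suc n) (suc k) ≈ qint q (2 ℕ.* suc k) * rhs n k + qint q (suc (2 ℕ.* suc k)) * rhs n (suc k)
    rhs-suc n k = begin
      term (suc n) K 0 + ∑[ l < K ] term (suc n) K (suc l)
        ≈⟨ +-cong (term-suc-zero n K) (∑-cong K (λ l _ → term-suc-suc n k l)) ⟩
      keepPart n K 0 + ∑[ l < K ] (keepPart n K (suc l) + risePart n k l)      ≈⟨ +-congˡ (∑-+ (keepPart n K ∘ suc) (risePart n k) K) ⟩
      keepPart n K 0 + (∑ K (keepPart n K ∘ suc) + ∑ K (risePart n k))         ≈⟨ sym (+-assoc _ _ _) ⟩
      ∑ (suc K) (keepPart n K) + ∑ K (risePart n k)                            ≈⟨ +-congʳ (∑-last (keepPart n K) K) ⟩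
      (∑ K (keepPart n K) + keepPart n K K) + ∑ K (risePart n k)
        ≈⟨ solve 3 (λ a b c → (a :+ b) :+ c := (a :+ c) :+ b) refl (∑ K (keepPart n K)) (keepPart n K K) (∑ K (risePart n k)) ⟩
      (∑ K (keepPart n K) + ∑ K (risePart n k)) + keepPart n K K               ≈⟨ +-congʳ (sym (∑-+ (keepPart n K) (risePart n k) K)) ⟩
      ∑[ l < K ] (keepPart n K l + risePart n k l) + keepPart n K K
        ≈⟨ +-cong (∑-cong K (λ l l<K → pair-identity n k l (ℕ.≤-pred l<K))) (top-identity n K) ⟩
      ∑[ l < K ] (c₀ * term n k l + c₁ * term n K l) + c₁ * term n K K        ≈⟨ +-congʳ (∑-+ (λ l → c₀ * term n k l) (λ l → c₁ * term n K l) K) ⟩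
      (∑[ l < K ] (c₀ * term n k l) + ∑[ l < K ] (c₁ * term n K l)) + c₁ * term n K K ≈⟨ +-assoc _ _ _ ⟩
      ∑[ l < K ] (c₀ * term n k l) + (∑[ l < K ] (c₁ * term n K l) + c₁ * term n K K) ≈⟨ +-congˡ (sym (∑-last (λ l → c₁ * term n K l) K)) ⟩
      ∑[ l < K ] (c₀ * term n k l) + ∑[ l < suc K ] (c₁ * term n K l)         ≈⟨ sym (+-cong (*-∑ c₀ (term n k) K) (*-∑ c₁ (term n K) (suc K))) ⟩
      c₀ * rhs n k + c₁ * rhs n K                                             ∎
      where
        K = suc k
        c₀ = qint q (2 ℕ.* K)
        c₁ = qint q (suc (2 ℕ.* K))

    -- The recurrence of the left-hand side

    lhs : ℕ → ℕ → Carrier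
    lhs n k = (qint q 2 ^ k) * qfact (q * q) k * SB n k

    lhs-suc-zero : ∀ n → lhs (suc n) 0 ≈ lhs n 0
    lhs-suc-zero n = *-congˡ (trans (*-congʳ (qint-1 q)) (*-identityˡ _))

    lhs-suc : ∀ n k → lhs (suc n) (suc k) ≈ qint q (2 ℕ.* suc k) * lhs n k + qint q (suc (2 ℕ.* suc k)) * lhs n (suc k)
    lhs-suc n k = begin
      (a * P) * (F * Y) * (S₀ + qint q (2 ℕ.* suc k ℕ.+ 1) * S₁)
        ≡⟨ ≡.cong (λ i → (a * P) * (F * Y) * (S₀ + qint q i * S₁)) (ℕ.+-comm (2 ℕ.* suc k) 1) ⟩
      (a * P) * (F * Y) * (S₀ + c₁ * S₁)
        ≈⟨ solve 7 (λ a p f y s₀ c s₁ → (a :* p) :* (f :* y) :* (s₀ :+ c :* s₁) := (a :* y) :* (p :* f :* s₀) :+ c :* ((a :* p) :* (f :* y) :* s₁))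
             refl a P F Y S₀ c₁ S₁ ⟩
      (a * Y) * lhs n k + c₁ * lhs n (suc k)                      ≈⟨ +-congʳ (*-congʳ (sym (qint-double q (suc k)))) ⟩
      qint q (2 ℕ.* suc k) * lhs n k + c₁ * lhs n (suc k)         ∎
      where
        a = qint q 2
        P = a ^ k
        F = qfact (q * q) k
        Y = qint (q * q) (suc k)
        S₀ = SB n k
        S₁ = SB n (suc k)
        c₁ = qint q (suc (2 ℕ.* suc k))

    lhs≈rhs : ∀ n k → lhs n k ≈ rhs n k
    lhs≈rhs zero zero = begin
      1# * 1# * 1#                ≈⟨ *-identityʳ _ ⟩
      1# * 1#                     ≈⟨ *-congˡ (sym (+-identityʳ 1#)) ⟩
      1# * (1# + 0#)              ≈⟨ sym (*-identityʳ _) ⟩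
      1# * (1# + 0#) * 1#         ≈⟨ sym (+-identityʳ _) ⟩
      rhs 0 0                     ∎
    lhs≈rhs zero (suc k) = trans (zeroʳ _) (sym (∑-zero (term 0 (suc k)) (suc (suc k)) vanish))
      where
        vanish : ∀ i → i < suc (suc k) → term 0 (suc k) i ≈ 0#
        vanish zero _ = zeroʳ _
        vanish (suc i) _ = vanishing _ refl
    lhs≈rhs (suc n) zero = trans (lhs-suc-zero n) (trans (lhs≈rhs n 0) (sym (rhs-suc-zero n)))
    lhs≈rhs (suc n) (suc k) = begin
      lhs (suc n) (suc k)                                                         ≈⟨ lhs-suc n k ⟩
      qint q (2 ℕ.* suc k) * lhs n k + qint q (suc (2 ℕ.* suc k)) * lhs n (suc k) ≈⟨ +-cong (*-congˡ (lhs≈rhs n k)) (*-congˡ (lhs≈rhs n (suc k))) ⟩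
      qint q (2 ℕ.* suc k) * rhs n k + qint q (suc (2 ℕ.* suc k)) * rhs n (suc k) ≈⟨ sym (rhs-suc n k) ⟩
      rhs (suc n) (suc k)                                                         ∎

theorem1p1 : ∀ {c ℓ : Level} (R : CommutativeRing c ℓ)
    (q q⁻¹ : CommutativeRing.Carrier R) →
    CommutativeRing._≈_ R (CommutativeRing._*_ R q q⁻¹) (CommutativeRing.1# R) →
    (n k : ℕ) → k ≤ n →
    let open CommutativeRing R
        open QAnalogues R q q⁻¹
    in (qint q 2 ^ k) * qfact (q * q) k * SB n k
       ≈ sumR (map (λ l → qᶻ (+ k ℤ.* (+ k ℤ.- + (2 ℕ.* l))) * Bnk n l * qbinom (q * q) (n ∸ l) (k ∸ l))
                   (upTo (ℕ.suc k)))
-- the identity holds for all k: both sides vanish when k > n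
theorem1p1 R q q⁻¹ qq⁻¹≈1 n k _ =
  trans (lhs≈rhs qq⁻¹≈1 n k) (reflexive (≡.sym (sumR-upTo (term qq⁻¹≈1 n k) (ℕ.suc k))))
  where
    open CommutativeRing R
    open Identity R q q⁻¹
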